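{- Let $n$ be a positive integer and $B$ an indeterminate. Then $${}_5F_4\!\left[\begin{matrix}1-\frac{2n}{3},\ -\frac{n}{2},\ \frac12-\frac n2,\ -2n-B,\ 2n+2B\\ -\frac{2n}{3},\ 1-n,\ \frac12+\frac B2,\ 1+\frac B2\end{matrix};1\right]=\frac12\,\frac{(2n+2B)_n}{(1+B)_n}.$$
   Context: $(a)_k=a(a+1)\cdots(a+k-1)$ for $k\ge1$, $(a)_0=1$. ${}_rF_s\!\left[\begin{matrix}a_1,\dots,a_r\\ b_1,\dots,b_s\end{matrix};z\right]=\sum_{k\ge0}\frac{(a_1)_k\cdots(a_r)_k}{k!\,(b_1)_k\cdots(b_s)_k}z^k$; here the sum terminates and runs over $0\le k\le\lfloor n/2\rfloor$. -}

module Defs where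

open import Data.Nat as ℕ using (ℕ; zero; suc)
open import Data.Integer using (+_)
open import Data.Rational using (ℚ; 0ℚ; 1ℚ; _+_; _*_; _-_; _/_; 1/_; _≟_)
open import Relation.Nullary using (yes; no)

nℚ : ℕ → ℚ
nℚ n = + n / 1

-- total inverse: inv 0 = 0 (only used where the argument is assumed nonzero)
inv : ℚ → ℚ
inv p with p ≟ 0ℚ
... | yes _ = 0ℚ
... | no p≢0 = 1/_ p {{Data.Rational.≢-nonZero p≢0}}

poch : ℚ → ℕ → ℚ
poch a zero = 1ℚ
poch a (suc k) = poch a k * (a + nℚ k)

fact : ℕ → ℚ
fact zero = 1ℚ
fact (suc k) = fact k * nℚ (suc k)

term54 : ℚ → ℚ → ℚ → ℚ → ℚ → ℚ → ℚ → ℚ → ℚ → ℕ → ℚ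
term54 a1 a2 a3 a4 a5 b1 b2 b3 b4 k =
  (poch a1 k * poch a2 k * poch a3 k * poch a4 k * poch a5 k)
  * inv (fact k * poch b1 k * poch b2 k * poch b3 k * poch b4 k)

sumTo : ℕ → (ℕ → ℚ) → ℚ
sumTo zero f = f 0
sumTo (suc m) f = sumTo m f + f (suc m)

F54 : ℕ → ℚ → ℚ → ℚ → ℚ → ℚ → ℚ → ℚ → ℚ → ℚ → ℚ
F54 m a1 a2 a3 a4 a5 b1 b2 b3 b4 = sumTo m (term54 a1 a2 a3 a4 a5 b1 b2 b3 b4)

{-# OPTIONS --safe #-}
module Submission where

-- Write S(n, B) for the left-hand side, t(n, B, k) for its summand and R(n, B) for the right-hand
-- side. Both S and R satisfy
--   (1 + B) X(n + 1, B) = (3n + 2B + 2) X(n, B + 1)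
-- and equal 1 at n = 1, so they agree by induction on n, shifting B at each step. For R the
-- recurrence is immediate. For S it is proved by creative telescoping in k: the terms
-- a(k) = (1 + B) t(n + 1, B, k) and b(k) = (3n + 2B + 2) t(n, B + 1, k) satisfy
-- a(k) - b(k) = H(k + 1) - H(k), where H(0) = 0 and H(k + 1) is an explicit rational function of
-- n, k, B times the 4F3 term c(k) obtained from t(n, B + 1, k) by dropping (1 - 2n/3)_k/(-2n/3)_k.
-- Expressing a(k + 1), b(k + 1), H(k + 1) and H(k + 2) as c(k) times rational functions turns each
-- step into a polynomial identity. Summing, only H at the top index survives, and it cancels
-- against the last terms of the two sums, whose ranges ⌊(n + 1)/2⌋ and ⌊n/2⌋ depend on the parity
-- of n. Every denominator met on the way is nonzero because (1 + B)_n ≠ 0.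

open import Defs
open import Data.Nat as ℕ using (ℕ; zero; suc; _≤_; _<_; z≤n; s≤s)
import Data.Nat.Properties as ℕP
open import Data.Nat.DivMod as ℕD using ()
open import Data.Integer as ℤ using (+_)
import Data.Integer.Properties as ℤP
import Data.Integer.Tactic.RingSolver as ℤSolver
open import Data.Rational using (ℚ; 0ℚ; 1ℚ; ½; _+_; _*_; _-_; -_; _/_; _≟_; toℚᵘ)
import Data.Rational.Properties as ℚP
open import Data.Rational.Unnormalised as ℚᵘ using (mkℚᵘ; *≡*)
import Data.Rational.Unnormalised.Properties as ℚᵘP
open import Algebra.Properties.Group ℚP.+-0-group using (x∙y⁻¹≈ε⇒x≈y)
open import Data.Product using (_×_; _,_; ∃-syntax)
open import Data.Sum using (_⊎_; inj₁; inj₂; [_,_]′)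
open import Relation.Nullary using (Dec; yes; no; contradiction)
open import Relation.Nullary.Decidable using (dec⇒maybe)
open import Relation.Binary.PropositionalEquality
open import Algebra.Bundles using (CommutativeMonoid)
open import Algebra.Properties.CommutativeSemigroup (CommutativeMonoid.commutativeSemigroup ℚP.*-1-commutativeMonoid) using () renaming (interchange to *-interchange)
import Tactic.RingSolver.Core.AlmostCommutativeRing as ACR
open import Tactic.RingSolver using (solve-∀)

ℚ-ring : ACR.AlmostCommutativeRing _ _
ℚ-ring = ACR.fromCommutativeRing ℚP.+-*-commutativeRing (λ x → dec⇒maybe (0ℚ ≟ x))

*-invʳ : ∀ p → p ≢ 0ℚ → p * inv p ≡ 1ℚ
*-invʳ p p≢0 with p ≟ 0ℚ
... | yes p≡0 = contradiction p≡0 p≢0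
... | no p≢0′ = ℚP.*-inverseʳ p {{Data.Rational.≢-nonZero p≢0′}}

*≢0 : ∀ {p q} → p ≢ 0ℚ → q ≢ 0ℚ → p * q ≢ 0ℚ
*≢0 {p} {q} p≢0 q≢0 pq≡0 = ℚP.1≢0 (begin
  1ℚ                        ≡⟨ cong₂ _*_ (*-invʳ p p≢0) (*-invʳ q q≢0) ⟨
  (p * inv p) * (q * inv q) ≡⟨ *-interchange p (inv p) q (inv q) ⟩
  (p * q) * (inv p * inv q) ≡⟨ cong (_* (inv p * inv q)) pq≡0 ⟩
  0ℚ * (inv p * inv q)      ≡⟨ ℚP.*-zeroˡ (inv p * inv q) ⟩
  0ℚ                        ∎)
  where open ≡-Reasoning

*≢0ˡ : ∀ {p} q → p * q ≢ 0ℚ → p ≢ 0ℚ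
*≢0ˡ q pq≢0 refl = pq≢0 (ℚP.*-zeroˡ q)

*≢0ʳ : ∀ p {q} → p * q ≢ 0ℚ → q ≢ 0ℚ
*≢0ʳ p pq≢0 refl = pq≢0 (ℚP.*-zeroʳ p)

inv-unique : ∀ p {u v} → p * u ≡ 1ℚ → p * v ≡ 1ℚ → u ≡ v
inv-unique p {u} {v} pu≡1 pv≡1 = begin
  u             ≡⟨ ℚP.*-identityʳ u ⟨
  u * 1ℚ        ≡⟨ cong (u *_) pv≡1 ⟨
  u * (p * v)   ≡⟨ regroup u p v ⟩
  (p * u) * v   ≡⟨ cong (_* v) pu≡1 ⟩
  1ℚ * v        ≡⟨ ℚP.*-identityˡ v ⟩
  v             ∎
  where
  open ≡-Reasoning
  regroup : ∀ a b c → a * (b * c) ≡ (b * a) * c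
  regroup = solve-∀ ℚ-ring

inv-* : ∀ p q → inv (p * q) ≡ inv p * inv q
inv-* p q = by-cases (p ≟ 0ℚ) (q ≟ 0ℚ)
  where
  open ≡-Reasoning
  by-cases : Dec (p ≡ 0ℚ) → Dec (q ≡ 0ℚ) → inv (p * q) ≡ inv p * inv q
  by-cases (yes refl) _ = trans (cong inv (ℚP.*-zeroˡ q)) (sym (ℚP.*-zeroˡ (inv q)))
  by-cases (no _) (yes refl) = trans (cong inv (ℚP.*-zeroʳ p)) (sym (ℚP.*-zeroʳ (inv p)))
  by-cases (no p≢0) (no q≢0) = inv-unique (p * q) (*-invʳ (p * q) (*≢0 p≢0 q≢0)) (begin
    (p * q) * (inv p * inv q)  ≡⟨ *-interchange p q (inv p) (inv q) ⟩
    (p * inv p) * (q * inv q)  ≡⟨ cong₂ _*_ (*-invʳ p p≢0) (*-invʳ q q≢0) ⟩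
    1ℚ                         ∎)

*-inv-cancelʳ : ∀ p {d} → d ≢ 0ℚ → (p * d) * inv d ≡ p
*-inv-cancelʳ p {d} d≢0 = begin
  (p * d) * inv d  ≡⟨ ℚP.*-assoc p d (inv d) ⟩
  p * (d * inv d)  ≡⟨ cong (p *_) (*-invʳ d d≢0) ⟩
  p * 1ℚ           ≡⟨ ℚP.*-identityʳ p ⟩
  p                ∎
  where open ≡-Reasoning

*-inv-extend : ∀ p d {l D} → d * l ≡ D → l ≢ 0ℚ → p * inv d ≡ (p * l) * inv D
*-inv-extend p d {l} refl l≢0 = begin
  p * inv d                    ≡⟨ *-inv-cancelʳ (p * inv d) l≢0 ⟨
  ((p * inv d) * l) * inv l    ≡⟨ regroup p l (inv d) (inv l) ⟩
  (p * l) * (inv d * inv l)    ≡⟨ cong ((p * l) *_) (inv-* d l) ⟨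
  (p * l) * inv (d * l)        ∎
  where
  open ≡-Reasoning
  regroup : ∀ a b c e → ((a * c) * b) * e ≡ (a * b) * (c * e)
  regroup = solve-∀ ℚ-ring

*-cancelˡ-≡ : ∀ c {a b} → c ≢ 0ℚ → c * a ≡ c * b → a ≡ b
*-cancelˡ-≡ c {a} {b} c≢0 ca≡cb = begin
  a                  ≡⟨ *-inv-cancelʳ a c≢0 ⟨
  (a * c) * inv c    ≡⟨ cong (λ t → t * inv c) (trans (ℚP.*-comm a c) (trans ca≡cb (ℚP.*-comm c b))) ⟩
  (b * c) * inv c    ≡⟨ *-inv-cancelʳ b c≢0 ⟩
  b                  ∎
  where open ≡-Reasoning

scaled-quotient-product : ∀ c r s U p q →
  c * ((r * inv s) * (U * (p * inv q)))
  ≡ U * ((c * r * p) * inv (s * q))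
scaled-quotient-product c r s U p q = begin
  c * ((r * inv s) * (U * (p * inv q)))    ≡⟨ regroup c r U p (inv s) (inv q) ⟩
  U * ((c * r * p) * (inv s * inv q))      ≡⟨ cong (λ t → U * ((c * r * p) * t)) (inv-* s q) ⟨
  U * ((c * r * p) * inv (s * q))          ∎
  where
  open ≡-Reasoning
  regroup : ∀ c r U p s q → c * ((r * s) * (U * (p * q))) ≡ U * ((c * r * p) * (s * q))
  regroup = solve-∀ ℚ-ring

quotient-product : ∀ U p q r s → (U * (p * inv q)) * (r * inv s) ≡ U * ((p * r) * inv (q * s))
quotient-product U p q r s = begin
  (U * (p * inv q)) * (r * inv s)   ≡⟨ regroup U p r (inv q) (inv s) ⟩
  U * ((p * r) * (inv q * inv s))   ≡⟨ cong (λ t → U * ((p * r) * t)) (inv-* q s) ⟨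
  U * ((p * r) * inv (q * s))       ∎
  where
  open ≡-Reasoning
  regroup : ∀ U p r q s → (U * (p * q)) * (r * s) ≡ U * ((p * r) * (q * s))
  regroup = solve-∀ ℚ-ring

over-common-denominator : ∀ U p d {m D} → d * m ≡ D → m ≢ 0ℚ → U * (p * inv d) ≡ (U * inv D) * (p * m)
over-common-denominator U p d {m} {D} dm≡D m≢0 = begin
  U * (p * inv d)          ≡⟨ cong (U *_) (*-inv-extend p d dm≡D m≢0) ⟩
  U * ((p * m) * inv D)    ≡⟨ regroup U (p * m) (inv D) ⟩
  (U * inv D) * (p * m)    ∎
  where
  open ≡-Reasoning
  regroup : ∀ U q i → U * (q * i) ≡ (U * i) * q
  regroup = solve-∀ ℚ-ring

scale-difference : ∀ W {X Y Z V} → X - Y ≡ Z - V → W * X - W * Y ≡ W * Z - W * V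
scale-difference W {X} {Y} {Z} {V} eq = begin
  W * X - W * Y    ≡⟨ factor W X Y ⟩
  W * (X - Y)      ≡⟨ cong (W *_) eq ⟩
  W * (Z - V)      ≡⟨ factor W Z V ⟨
  W * Z - W * V    ∎
  where
  open ≡-Reasoning
  factor : ∀ W X Y → W * X - W * Y ≡ W * (X - Y)
  factor = solve-∀ ℚ-ring

/-suc : ∀ a d → + suc a / suc d ≡ + a / suc d + + 1 / suc d
/-suc a d = ℚP.toℚᵘ-injective (begin-equality
  toℚᵘ (+ suc a / suc d)                          ≃⟨ ℚP.toℚᵘ-fromℚᵘ (mkℚᵘ (+ suc a) d) ⟩
  mkℚᵘ (+ suc a) d                                ≃⟨ *≡* (cross-multiplied (+ a) (+ suc d)) ⟩
  mkℚᵘ (+ a) d ℚᵘ.+ mkℚᵘ (+ 1) d                  ≃⟨ ℚᵘP.+-cong (ℚP.toℚᵘ-fromℚᵘ (mkℚᵘ (+ a) d)) (ℚP.toℚᵘ-fromℚᵘ (mkℚᵘ (+ 1) d)) ⟨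
  toℚᵘ (+ a / suc d) ℚᵘ.+ toℚᵘ (+ 1 / suc d)      ≃⟨ ℚP.toℚᵘ-homo-+ (+ a / suc d) (+ 1 / suc d) ⟨
  toℚᵘ (+ a / suc d + + 1 / suc d)                ∎)
  where
  open ℚᵘP.≤-Reasoning
  cross-multiplied : ∀ i n → (+ 1 ℤ.+ i) ℤ.* (n ℤ.* n) ≡ (i ℤ.* n ℤ.+ + 1 ℤ.* n) ℤ.* n
  cross-multiplied = ℤSolver.solve-∀

nℚ-suc : ∀ a → nℚ (suc a) ≡ nℚ a + 1ℚ
nℚ-suc a = /-suc a 0

i/n≡i*[1/n] : ∀ a d → + a / suc d ≡ nℚ a * (+ 1 / suc d)
i/n≡i*[1/n] zero d = trans (ℚP.0/n≡0 (suc d)) (sym (ℚP.*-zeroˡ (+ 1 / suc d)))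
i/n≡i*[1/n] (suc a) d = begin
  + suc a / suc d                              ≡⟨ /-suc a d ⟩
  + a / suc d + + 1 / suc d                    ≡⟨ cong (_+ + 1 / suc d) (i/n≡i*[1/n] a d) ⟩
  nℚ a * (+ 1 / suc d) + + 1 / suc d           ≡⟨ distrib (nℚ a) (+ 1 / suc d) ⟩
  (nℚ a + 1ℚ) * (+ 1 / suc d)                  ≡⟨ cong (_* (+ 1 / suc d)) (nℚ-suc a) ⟨
  nℚ (suc a) * (+ 1 / suc d)                   ∎
  where
  open ≡-Reasoning
  distrib : ∀ x c → x * c + c ≡ (x + 1ℚ) * c
  distrib = solve-∀ ℚ-ring

nℚ-+ : ∀ a b → nℚ (a ℕ.+ b) ≡ nℚ a + nℚ b
nℚ-+ zero b = sym (ℚP.+-identityˡ (nℚ b))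
nℚ-+ (suc a) b = begin
  nℚ (suc (a ℕ.+ b))    ≡⟨ nℚ-suc (a ℕ.+ b) ⟩
  nℚ (a ℕ.+ b) + 1ℚ     ≡⟨ cong (_+ 1ℚ) (nℚ-+ a b) ⟩
  nℚ a + nℚ b + 1ℚ      ≡⟨ swap (nℚ a) (nℚ b) ⟩
  nℚ a + 1ℚ + nℚ b      ≡⟨ cong (_+ nℚ b) (nℚ-suc a) ⟨
  nℚ (suc a) + nℚ b     ∎
  where
  open ≡-Reasoning
  swap : ∀ x y → x + y + 1ℚ ≡ x + 1ℚ + y
  swap = solve-∀ ℚ-ring

nℚ-* : ∀ a b → nℚ (a ℕ.* b) ≡ nℚ a * nℚ b
nℚ-* zero b = sym (ℚP.*-zeroˡ (nℚ b))
nℚ-* (suc a) b = begin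
  nℚ (b ℕ.+ a ℕ.* b)      ≡⟨ nℚ-+ b (a ℕ.* b) ⟩
  nℚ b + nℚ (a ℕ.* b)     ≡⟨ cong (λ t → nℚ b + t) (nℚ-* a b) ⟩
  nℚ b + nℚ a * nℚ b      ≡⟨ distrib (nℚ a) (nℚ b) ⟩
  (nℚ a + 1ℚ) * nℚ b      ≡⟨ cong (_* nℚ b) (nℚ-suc a) ⟨
  nℚ (suc a) * nℚ b       ∎
  where
  open ≡-Reasoning
  distrib : ∀ x y → y + x * y ≡ (x + 1ℚ) * y
  distrib = solve-∀ ℚ-ring

nℚ-injective : ∀ {a b} → nℚ a ≡ nℚ b → a ≡ b
nℚ-injective {a} {b} eq with ℚᵘP.≃-trans (ℚᵘP.≃-sym (ℚP.toℚᵘ-fromℚᵘ (mkℚᵘ (+ a) 0)))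
                               (ℚᵘP.≃-trans (ℚP.toℚᵘ-cong eq) (ℚP.toℚᵘ-fromℚᵘ (mkℚᵘ (+ b) 0)))
... | *≡* a*1≡b*1 = ℤP.+-injective (trans (sym (ℤP.*-identityʳ (+ a))) (trans a*1≡b*1 (ℤP.*-identityʳ (+ b))))

nℚ-≢ : ∀ {a b} → a ≢ b → nℚ a - nℚ b ≢ 0ℚ
nℚ-≢ {a} {b} a≢b eq = a≢b (nℚ-injective (x∙y⁻¹≈ε⇒x≈y (nℚ a) (nℚ b) eq))

nℚ-suc≢0 : ∀ k → nℚ k + 1ℚ ≢ 0ℚ
nℚ-suc≢0 k eq = ℕP.1+n≢0 (nℚ-injective {suc k} {0} (trans (nℚ-suc k) eq))

nℚ-2k+1 : ∀ k → nℚ (suc (k ℕ.+ k)) ≡ nℚ k + nℚ k + 1ℚ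
nℚ-2k+1 k = trans (nℚ-suc (k ℕ.+ k)) (cong (_+ 1ℚ) (nℚ-+ k k))

poch-suc-shift : ∀ a k → poch a (suc k) ≡ a * poch (a + 1ℚ) k
poch-suc-shift a zero = shift a
  where
  shift : ∀ a → 1ℚ * (a + 0ℚ) ≡ a * 1ℚ
  shift = solve-∀ ℚ-ring
poch-suc-shift a (suc k) = begin
  poch a (suc k) * (a + nℚ (suc k))          ≡⟨ cong₂ (λ p t → p * (a + t)) (poch-suc-shift a k) (nℚ-suc k) ⟩
  a * poch (a + 1ℚ) k * (a + (nℚ k + 1ℚ))    ≡⟨ regroup a (poch (a + 1ℚ) k) (nℚ k) ⟩
  a * (poch (a + 1ℚ) k * (a + 1ℚ + nℚ k))    ∎
  where
  open ≡-Reasoning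
  regroup : ∀ a p K → a * p * (a + (K + 1ℚ)) ≡ a * (p * (a + 1ℚ + K))
  regroup = solve-∀ ℚ-ring

poch≢0 : ∀ a k → (∀ j → j < k → a + nℚ j ≢ 0ℚ) → poch a k ≢ 0ℚ
poch≢0 a zero factors≢0 = ℚP.1≢0
poch≢0 a (suc k) factors≢0 =
  *≢0 (poch≢0 a k (λ j j<k → factors≢0 j (ℕP.m<n⇒m<1+n j<k))) (factors≢0 k (ℕP.n<1+n k))

poch≢0⁻¹ : ∀ a k → poch a k ≢ 0ℚ → ∀ j → j < k → a + nℚ j ≢ 0ℚ
poch≢0⁻¹ a (suc k) p≢0 j j<1+k with ℕP.m<1+n⇒m<n∨m≡n j<1+k
... | inj₁ j<k = poch≢0⁻¹ a k (*≢0ˡ (a + nℚ k) p≢0) j j<k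
... | inj₂ refl = *≢0ʳ (poch a k) p≢0

poch-shift-ratio : ∀ a k → (∀ j → j ≤ k → a + nℚ j ≢ 0ℚ) →
  poch (a + 1ℚ) k * inv (poch a k) ≡ (a + nℚ k) * inv a
poch-shift-ratio a k factors≢0 = begin
  poch (a + 1ℚ) k * inv (poch a k)                ≡⟨ *-inv-extend (poch (a + 1ℚ) k) (poch a k) refl a≢0 ⟩
  (poch (a + 1ℚ) k * a) * inv (poch a k * a)      ≡⟨ cong₂ (λ p q → p * inv q) shifted (ℚP.*-comm (poch a k) a) ⟩
  ((a + nℚ k) * poch a k) * inv (a * poch a k)    ≡⟨ *-inv-extend (a + nℚ k) a refl p≢0 ⟨
  (a + nℚ k) * inv a                              ∎
  where
  open ≡-Reasoning
  a≢0 : a ≢ 0ℚ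
  a≢0 refl = factors≢0 0 z≤n (ℚP.+-identityʳ 0ℚ)
  p≢0 : poch a k ≢ 0ℚ
  p≢0 = poch≢0 a k (λ j j<k → factors≢0 j (ℕP.<⇒≤ j<k))
  shifted : poch (a + 1ℚ) k * a ≡ (a + nℚ k) * poch a k
  shifted = trans (ℚP.*-comm (poch (a + 1ℚ) k) a)
                  (trans (sym (poch-suc-shift a k)) (ℚP.*-comm (poch a k) (a + nℚ k)))

term43 : ℚ → ℚ → ℚ → ℚ → ℚ → ℚ → ℚ → ℕ → ℚ
term43 a₂ a₃ a₄ a₅ b₂ b₃ b₄ k =
  (poch a₂ k * poch a₃ k * poch a₄ k * poch a₅ k) * inv (fact k * poch b₂ k * poch b₃ k * poch b₄ k)

term43-cong : ∀ {a₂ a₃ a₄ a₅ b₂ b₃ b₄ a₂′ a₃′ a₄′ a₅′ b₂′ b₃′ b₄′} →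
  a₂ ≡ a₂′ → a₃ ≡ a₃′ → a₄ ≡ a₄′ → a₅ ≡ a₅′ → b₂ ≡ b₂′ → b₃ ≡ b₃′ → b₄ ≡ b₄′ →
  ∀ k → term43 a₂ a₃ a₄ a₅ b₂ b₃ b₄ k ≡ term43 a₂′ a₃′ a₄′ a₅′ b₂′ b₃′ b₄′ k
term43-cong refl refl refl refl refl refl refl k = refl

term54-split : ∀ a₁ a₂ a₃ a₄ a₅ b₁ b₂ b₃ b₄ k →
  term54 a₁ a₂ a₃ a₄ a₅ b₁ b₂ b₃ b₄ k ≡ (poch a₁ k * inv (poch b₁ k)) * term43 a₂ a₃ a₄ a₅ b₂ b₃ b₄ k
term54-split a₁ a₂ a₃ a₄ a₅ b₁ b₂ b₃ b₄ k = begin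
  (p₁ * p₂ * p₃ * p₄ * p₅) * inv (f * q₁ * q₂ * q₃ * q₄)
    ≡⟨ cong₂ (λ u v → u * inv v) (pull-first p₁ p₂ p₃ p₄ p₅) (pull-second f q₁ q₂ q₃ q₄) ⟩
  (p₁ * (p₂ * p₃ * p₄ * p₅)) * inv (q₁ * (f * q₂ * q₃ * q₄))
    ≡⟨ cong ((p₁ * (p₂ * p₃ * p₄ * p₅)) *_) (inv-* q₁ (f * q₂ * q₃ * q₄)) ⟩
  (p₁ * (p₂ * p₃ * p₄ * p₅)) * (inv q₁ * inv (f * q₂ * q₃ * q₄))
    ≡⟨ *-interchange p₁ (p₂ * p₃ * p₄ * p₅) (inv q₁) (inv (f * q₂ * q₃ * q₄)) ⟩
  (p₁ * inv q₁) * term43 a₂ a₃ a₄ a₅ b₂ b₃ b₄ k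
    ∎
  where
  open ≡-Reasoning
  p₁ = poch a₁ k; p₂ = poch a₂ k; p₃ = poch a₃ k; p₄ = poch a₄ k; p₅ = poch a₅ k
  f = fact k; q₁ = poch b₁ k; q₂ = poch b₂ k; q₃ = poch b₃ k; q₄ = poch b₄ k
  pull-first : ∀ a b c d e → a * b * c * d * e ≡ a * (b * c * d * e)
  pull-first = solve-∀ ℚ-ring
  pull-second : ∀ a b c d e → a * b * c * d * e ≡ b * (a * c * d * e)
  pull-second = solve-∀ ℚ-ring

pairs⁴ : ∀ a₁ b₁ a₂ b₂ a₃ b₃ a₄ b₄ →
  (a₁ * b₁) * (a₂ * b₂) * (a₃ * b₃) * (a₄ * b₄) ≡ (a₁ * a₂ * a₃ * a₄) * (b₁ * b₂ * b₃ * b₄)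
pairs⁴ a₁ b₁ a₂ b₂ a₃ b₃ a₄ b₄ = begin
  (a₁ * b₁) * (a₂ * b₂) * (a₃ * b₃) * (a₄ * b₄)   ≡⟨ cong (λ t → t * (a₃ * b₃) * (a₄ * b₄)) (*-interchange a₁ b₁ a₂ b₂) ⟩
  (a₁ * a₂) * (b₁ * b₂) * (a₃ * b₃) * (a₄ * b₄)   ≡⟨ cong (_* (a₄ * b₄)) (*-interchange (a₁ * a₂) (b₁ * b₂) a₃ b₃) ⟩
  (a₁ * a₂ * a₃) * (b₁ * b₂ * b₃) * (a₄ * b₄)     ≡⟨ *-interchange (a₁ * a₂ * a₃) (b₁ * b₂ * b₃) a₄ b₄ ⟩
  (a₁ * a₂ * a₃ * a₄) * (b₁ * b₂ * b₃ * b₄)       ∎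
  where open ≡-Reasoning

split-quotient : ∀ p₁ p₂ p₃ p₄ q₁ q₂ q₃ q₄ d₁ d₂ d₃ d₄ e₁ e₂ e₃ e₄ →
  ((p₁ * q₁) * (p₂ * q₂) * (p₃ * q₃) * (p₄ * q₄)) * inv ((d₁ * e₁) * (d₂ * e₂) * (d₃ * e₃) * (d₄ * e₄))
  ≡ ((p₁ * p₂ * p₃ * p₄) * inv (d₁ * d₂ * d₃ * d₄)) * ((q₁ * q₂ * q₃ * q₄) * inv (e₁ * e₂ * e₃ * e₄))
split-quotient p₁ p₂ p₃ p₄ q₁ q₂ q₃ q₄ d₁ d₂ d₃ d₄ e₁ e₂ e₃ e₄ = begin
  ((p₁ * q₁) * (p₂ * q₂) * (p₃ * q₃) * (p₄ * q₄)) * inv ((d₁ * e₁) * (d₂ * e₂) * (d₃ * e₃) * (d₄ * e₄))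
    ≡⟨ cong₂ (λ u v → u * inv v) (pairs⁴ p₁ q₁ p₂ q₂ p₃ q₃ p₄ q₄) (pairs⁴ d₁ e₁ d₂ e₂ d₃ e₃ d₄ e₄) ⟩
  (P * Q) * inv (D * E)          ≡⟨ cong ((P * Q) *_) (inv-* D E) ⟩
  (P * Q) * (inv D * inv E)      ≡⟨ *-interchange P Q (inv D) (inv E) ⟩
  (P * inv D) * (Q * inv E)      ∎
  where
  open ≡-Reasoning
  P = p₁ * p₂ * p₃ * p₄
  Q = q₁ * q₂ * q₃ * q₄
  D = d₁ * d₂ * d₃ * d₄
  E = e₁ * e₂ * e₃ * e₄

term43-suc : ∀ a₂ a₃ a₄ a₅ b₂ b₃ b₄ k → let K = nℚ k in
  term43 a₂ a₃ a₄ a₅ b₂ b₃ b₄ (suc k)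
  ≡ term43 a₂ a₃ a₄ a₅ b₂ b₃ b₄ k
    * (((a₂ + K) * (a₃ + K) * (a₄ + K) * (a₅ + K)) * inv (nℚ (suc k) * (b₂ + K) * (b₃ + K) * (b₄ + K)))
term43-suc a₂ a₃ a₄ a₅ b₂ b₃ b₄ k = split-quotient
  (poch a₂ k) (poch a₃ k) (poch a₄ k) (poch a₅ k) (a₂ + K) (a₃ + K) (a₄ + K) (a₅ + K)
  (fact k) (poch b₂ k) (poch b₃ k) (poch b₄ k) (nℚ (suc k)) (b₂ + K) (b₃ + K) (b₄ + K)
  where K = nℚ k

term43-suc-shift : ∀ a₂ a₃ a₄ a₅ b₂ b₃ b₄ k → let K = nℚ k in
  term43 a₂ a₃ a₄ a₅ b₂ b₃ b₄ (suc k)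
  ≡ term43 a₃ (a₂ + 1ℚ) (a₄ + 1ℚ) a₅ (b₂ + 1ℚ) b₄ (b₃ + 1ℚ) k
    * ((a₂ * (a₃ + K) * a₄ * (a₅ + K)) * inv (nℚ (suc k) * b₂ * b₃ * (b₄ + K)))
term43-suc-shift a₂ a₃ a₄ a₅ b₂ b₃ b₄ k = begin
  (poch a₂ (suc k) * poch a₃ (suc k) * poch a₄ (suc k) * poch a₅ (suc k))
    * inv (fact (suc k) * poch b₂ (suc k) * poch b₃ (suc k) * poch b₄ (suc k))
    ≡⟨ cong₂ (λ p q → p * inv q)
         (trans (reorderᴺ (poch a₂ (suc k)) (poch a₃ (suc k)) (poch a₄ (suc k)) (poch a₅ (suc k)))
                (cong₂ (λ s t → poch a₃ (suc k) * s * t * poch a₅ (suc k)) (shift a₂) (shift a₄)))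
         (trans (reorderᴰ (fact (suc k)) (poch b₂ (suc k)) (poch b₃ (suc k)) (poch b₄ (suc k)))
                (cong₂ (λ s t → fact (suc k) * s * poch b₄ (suc k) * t) (shift b₂) (shift b₃))) ⟩
  ((poch a₃ k * (a₃ + K)) * (poch (a₂ + 1ℚ) k * a₂) * (poch (a₄ + 1ℚ) k * a₄) * (poch a₅ k * (a₅ + K)))
    * inv ((fact k * nℚ (suc k)) * (poch (b₂ + 1ℚ) k * b₂) * (poch b₄ k * (b₄ + K)) * (poch (b₃ + 1ℚ) k * b₃))
    ≡⟨ split-quotient (poch a₃ k) (poch (a₂ + 1ℚ) k) (poch (a₄ + 1ℚ) k) (poch a₅ k) (a₃ + K) a₂ a₄ (a₅ + K)
         (fact k) (poch (b₂ + 1ℚ) k) (poch b₄ k) (poch (b₃ + 1ℚ) k) (nℚ (suc k)) b₂ (b₄ + K) b₃ ⟩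
  term43 a₃ (a₂ + 1ℚ) (a₄ + 1ℚ) a₅ (b₂ + 1ℚ) b₄ (b₃ + 1ℚ) k
    * (((a₃ + K) * a₂ * a₄ * (a₅ + K)) * inv (nℚ (suc k) * b₂ * (b₄ + K) * b₃))
    ≡⟨ cong₂ (λ p q → term43 a₃ (a₂ + 1ℚ) (a₄ + 1ℚ) a₅ (b₂ + 1ℚ) b₄ (b₃ + 1ℚ) k * (p * inv q))
         (reorderᴺ (a₃ + K) a₂ a₄ (a₅ + K)) (reorderᴰ (nℚ (suc k)) b₂ (b₄ + K) b₃) ⟩
  term43 a₃ (a₂ + 1ℚ) (a₄ + 1ℚ) a₅ (b₂ + 1ℚ) b₄ (b₃ + 1ℚ) k
    * ((a₂ * (a₃ + K) * a₄ * (a₅ + K)) * inv (nℚ (suc k) * b₂ * b₃ * (b₄ + K)))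
    ∎
  where
  open ≡-Reasoning
  K = nℚ k
  shift : ∀ a → poch a (suc k) ≡ poch (a + 1ℚ) k * a
  shift a = trans (poch-suc-shift a k) (ℚP.*-comm a (poch (a + 1ℚ) k))
  reorderᴺ : ∀ p q r s → p * q * r * s ≡ q * p * r * s
  reorderᴺ = solve-∀ ℚ-ring
  reorderᴰ : ∀ p q r s → p * q * r * s ≡ p * q * s * r
  reorderᴰ = solve-∀ ℚ-ring

sumTo-*-distribˡ : ∀ c (f : ℕ → ℚ) m → sumTo m (λ k → c * f k) ≡ c * sumTo m f
sumTo-*-distribˡ c f zero = refl
sumTo-*-distribˡ c f (suc m) = trans (cong (_+ c * f (suc m)) (sumTo-*-distribˡ c f m))
                                     (sym (ℚP.*-distribˡ-+ c (sumTo m f) (f (suc m))))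

[a+b]-[c+d]≡[a-c]+[b-d] : ∀ a b c d → (a + b) - (c + d) ≡ (a - c) + (b - d)
[a+b]-[c+d]≡[a-c]+[b-d] = solve-∀ ℚ-ring

sumTo-telescope : ∀ (f g h : ℕ → ℚ) m → (∀ k → k ≤ m → f k - g k ≡ h (suc k) - h k) →
  sumTo m f - sumTo m g ≡ h (suc m) - h 0
sumTo-telescope f g h zero step = step 0 z≤n
sumTo-telescope f g h (suc m) step = begin
  (sumTo m f + f (suc m)) - (sumTo m g + g (suc m))
    ≡⟨ [a+b]-[c+d]≡[a-c]+[b-d] (sumTo m f) (f (suc m)) (sumTo m g) (g (suc m)) ⟩
  (sumTo m f - sumTo m g) + (f (suc m) - g (suc m))
    ≡⟨ cong₂ _+_ (sumTo-telescope f g h m (λ k k≤m → step k (ℕP.m≤n⇒m≤1+n k≤m))) (step (suc m) ℕP.≤-refl) ⟩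
  (h (suc m) - h 0) + (h (suc (suc m)) - h (suc m))
    ≡⟨ collapse (h 0) (h (suc m)) (h (suc (suc m))) ⟩
  h (suc (suc m)) - h 0
    ∎
  where
  open ≡-Reasoning
  collapse : ∀ a b c → (b - a) + (c - b) ≡ c - a
  collapse = solve-∀ ℚ-ring

⅓ : ℚ
⅓ = + 1 / 3

summand : ℚ → ℚ → ℕ → ℚ
summand x B = term54 (1ℚ - nℚ 2 * x * ⅓) (- (x * ½)) (½ - x * ½) (- (nℚ 2 * x) - B) (nℚ 2 * x + nℚ 2 * B)
                     (- (nℚ 2 * x * ⅓)) (1ℚ - x) (½ + B * ½) (1ℚ + B * ½)

core : ℚ → ℚ → ℕ → ℚ
core x B = term43 (- (x * ½)) (½ - x * ½) (- (nℚ 2 * x) - B) (nℚ 2 * x + nℚ 2 * B) (1ℚ - x) (½ + B * ½) (1ℚ + B * ½)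

leading-ratio : ∀ x k → (∀ j → j ≤ k → - (nℚ 2 * x * ⅓) + nℚ j ≢ 0ℚ) →
  poch (1ℚ - nℚ 2 * x * ⅓) k * inv (poch (- (nℚ 2 * x * ⅓)) k) ≡ (- (nℚ 2 * x * ⅓) + nℚ k) * inv (- (nℚ 2 * x * ⅓))
leading-ratio x k factors≢0 =
  trans (cong (λ a → poch a k * inv (poch (- (nℚ 2 * x * ⅓)) k)) (shift x)) (poch-shift-ratio _ k factors≢0)
  where
  shift : ∀ x → 1ℚ - nℚ 2 * x * ⅓ ≡ - (nℚ 2 * x * ⅓) + 1ℚ
  shift = solve-∀ ℚ-ring

leading-factor≢0 : ∀ m j → 1 ≤ m → j ℕ.+ j ≤ m → - (nℚ 2 * nℚ m * ⅓) + nℚ j ≢ 0ℚ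
leading-factor≢0 m j 1≤m 2j≤m eq = ℕP.<⇒≢ 3j<2m (nℚ-injective (begin
  nℚ (j ℕ.+ (j ℕ.+ j))             ≡⟨ trans (nℚ-+ j (j ℕ.+ j)) (cong (λ t → nℚ j + t) (nℚ-+ j j)) ⟩
  nℚ j + (nℚ j + nℚ j)             ≡⟨ thrice (nℚ m) (nℚ j) ⟩
  nℚ 3 * (- (nℚ 2 * nℚ m * ⅓) + nℚ j) + (nℚ m + nℚ m)  ≡⟨ cong (λ t → nℚ 3 * t + (nℚ m + nℚ m)) eq ⟩
  nℚ 3 * 0ℚ + (nℚ m + nℚ m)        ≡⟨ ℚP.+-identityˡ (nℚ m + nℚ m) ⟩
  nℚ m + nℚ m                      ≡⟨ nℚ-+ m m ⟨
  nℚ (m ℕ.+ m)                     ∎))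
  where
  open ≡-Reasoning
  thrice : ∀ M J → J + (J + J) ≡ nℚ 3 * (- (nℚ 2 * M * ⅓) + J) + (M + M)
  thrice = solve-∀ ℚ-ring
  half<whole : ∀ j → j ℕ.+ j ≤ m → j < m
  half<whole zero _ = 1≤m
  half<whole (suc j) 2j≤m = ℕP.<-≤-trans (ℕP.m<m+n (suc j) (s≤s z≤n)) 2j≤m
  3j<2m : j ℕ.+ (j ℕ.+ j) < m ℕ.+ m
  3j<2m = ℕP.≤-<-trans (ℕP.+-monoʳ-≤ j 2j≤m) (ℕP.+-monoˡ-< m (half<whole j 2j≤m))

-- In the rational functions below x stands for n and K for k.
ratio-num : ℚ → ℚ → ℚ → ℚ
ratio-num x K B = (- (x * ½) + K) * (½ - x * ½ + K) * (- (nℚ 2 * x) - (B + 1ℚ) + K) * (nℚ 2 * x + nℚ 2 * (B + 1ℚ) + K)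

ratio-den : ℚ → ℚ → ℚ → ℚ
ratio-den x K B = (K + 1ℚ) * (1ℚ - x + K) * (½ + (B + 1ℚ) * ½ + K) * (1ℚ + (B + 1ℚ) * ½ + K)

core-suc : ∀ x B k → let K = nℚ k in
  core x (B + 1ℚ) (suc k) ≡ core x (B + 1ℚ) k * (ratio-num x K B * inv (ratio-den x K B))
core-suc x B k = trans (term43-suc _ _ _ _ _ _ _ k)
  (cong (λ t → core x (B + 1ℚ) k * (ratio-num x K B * inv (t * (1ℚ - x + K) * (½ + (B + 1ℚ) * ½ + K) * (1ℚ + (B + 1ℚ) * ½ + K))))
        (nℚ-suc k))
  where K = nℚ k

core-contiguous : ∀ x B k → let K = nℚ k; y = x + 1ℚ in
  core y B (suc k)
  ≡ core x (B + 1ℚ) k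
    * ((- (y * ½) * (½ - y * ½ + K) * (- (nℚ 2 * y) - B) * (nℚ 2 * y + nℚ 2 * B + K))
       * inv ((K + 1ℚ) * (1ℚ - y) * (½ + B * ½) * (1ℚ + B * ½ + K)))
core-contiguous x B k = trans (term43-suc-shift _ _ _ _ _ _ _ k)
  (cong₂ (λ u t → u * ((- (y * ½) * (½ - y * ½ + K) * (- (nℚ 2 * y) - B) * (nℚ 2 * y + nℚ 2 * B + K))
                       * inv (t * (1ℚ - y) * (½ + B * ½) * (1ℚ + B * ½ + K))))
         (term43-cong (e₁ x) (e₂ x) (e₃ x B) (e₄ x B) (e₅ x) (e₆ B) (e₇ B) k)
         (nℚ-suc k))
  where
  K = nℚ k
  y = x + 1ℚ
  e₁ : ∀ x → ½ - (x + 1ℚ) * ½ ≡ - (x * ½)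
  e₁ = solve-∀ ℚ-ring
  e₂ : ∀ x → - ((x + 1ℚ) * ½) + 1ℚ ≡ ½ - x * ½
  e₂ = solve-∀ ℚ-ring
  e₃ : ∀ x B → - (nℚ 2 * (x + 1ℚ)) - B + 1ℚ ≡ - (nℚ 2 * x) - (B + 1ℚ)
  e₃ = solve-∀ ℚ-ring
  e₄ : ∀ x B → nℚ 2 * (x + 1ℚ) + nℚ 2 * B ≡ nℚ 2 * x + nℚ 2 * (B + 1ℚ)
  e₄ = solve-∀ ℚ-ring
  e₅ : ∀ x → 1ℚ - (x + 1ℚ) + 1ℚ ≡ 1ℚ - x
  e₅ = solve-∀ ℚ-ring
  e₆ : ∀ B → 1ℚ + B * ½ ≡ ½ + (B + 1ℚ) * ½
  e₆ = solve-∀ ℚ-ring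
  e₇ : ∀ B → ½ + B * ½ + 1ℚ ≡ 1ℚ + (B + 1ℚ) * ½
  e₇ = solve-∀ ℚ-ring

coeff : ℚ → ℚ → ℚ
coeff x B = nℚ 3 * x + nℚ 2 * B + nℚ 2

lhs-term : ℕ → ℚ → ℕ → ℚ
lhs-term n B k = (1ℚ + B) * summand (nℚ (suc n)) B k

rhs-term : ℕ → ℚ → ℕ → ℚ
rhs-term n B k = coeff (nℚ n) B * summand (nℚ n) (B + 1ℚ) k

lhs-num : ℚ → ℚ → ℚ → ℚ
lhs-num x K B = (1ℚ + B) * (- (nℚ 2 * (x + 1ℚ) * ⅓) + (K + 1ℚ))
  * (- ((x + 1ℚ) * ½) * (½ - (x + 1ℚ) * ½ + K) * (- (nℚ 2 * (x + 1ℚ)) - B) * (nℚ 2 * (x + 1ℚ) + nℚ 2 * B + K))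

lhs-den : ℚ → ℚ → ℚ → ℚ
lhs-den x K B = - (nℚ 2 * (x + 1ℚ) * ⅓) * ((K + 1ℚ) * (1ℚ - (x + 1ℚ)) * (½ + B * ½) * (1ℚ + B * ½ + K))

rhs-num : ℚ → ℚ → ℚ → ℚ
rhs-num x K B = coeff x B * (- (nℚ 2 * x * ⅓) + (K + 1ℚ)) * ratio-num x K B

rhs-den : ℚ → ℚ → ℚ → ℚ
rhs-den x K B = - (nℚ 2 * x * ⅓) * ratio-den x K B

lhs-term-suc : ∀ n B k → suc k ℕ.+ suc k ≤ suc n → let x = nℚ n; K = nℚ k in
  lhs-term n B (suc k) ≡ core x (B + 1ℚ) k * (lhs-num x K B * inv (lhs-den x K B))
lhs-term-suc n B k bound = begin
  (1ℚ + B) * summand (nℚ (suc n)) B (suc k)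
    ≡⟨ cong (λ z → (1ℚ + B) * summand z B (suc k)) (nℚ-suc n) ⟩
  (1ℚ + B) * summand y B (suc k)
    ≡⟨ cong ((1ℚ + B) *_) (term54-split _ _ _ _ _ _ _ _ _ (suc k)) ⟩
  (1ℚ + B) * ((poch (1ℚ - nℚ 2 * y * ⅓) (suc k) * inv (poch β (suc k))) * core y B (suc k))
    ≡⟨ cong₂ (λ r c → (1ℚ + B) * (r * c)) (leading-ratio y (suc k) β+j≢0) (core-contiguous x B k) ⟩
  (1ℚ + B) * (((β + nℚ (suc k)) * inv β) * (core x (B + 1ℚ) k * (P * inv Q)))
    ≡⟨ scaled-quotient-product (1ℚ + B) (β + nℚ (suc k)) β (core x (B + 1ℚ) k) P Q ⟩
  core x (B + 1ℚ) k * (((1ℚ + B) * (β + nℚ (suc k)) * P) * inv (β * Q))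
    ≡⟨ cong (λ t → core x (B + 1ℚ) k * (((1ℚ + B) * (β + t) * P) * inv (β * Q))) (nℚ-suc k) ⟩
  core x (B + 1ℚ) k * (lhs-num x K B * inv (lhs-den x K B))
    ∎
  where
  open ≡-Reasoning
  x = nℚ n
  K = nℚ k
  y = x + 1ℚ
  β = - (nℚ 2 * y * ⅓)
  P = - (y * ½) * (½ - y * ½ + K) * (- (nℚ 2 * y) - B) * (nℚ 2 * y + nℚ 2 * B + K)
  Q = (K + 1ℚ) * (1ℚ - y) * (½ + B * ½) * (1ℚ + B * ½ + K)
  β+j≢0 : ∀ j → j ≤ suc k → β + nℚ j ≢ 0ℚ
  β+j≢0 j j≤1+k = subst (λ z → - (nℚ 2 * z * ⅓) + nℚ j ≢ 0ℚ) (nℚ-suc n)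
    (leading-factor≢0 (suc n) j (s≤s z≤n) (ℕP.≤-trans (ℕP.+-mono-≤ j≤1+k j≤1+k) bound))

rhs-term-suc : ∀ n B k → 1 ≤ n → suc k ℕ.+ suc k ≤ n → let x = nℚ n; K = nℚ k in
  rhs-term n B (suc k) ≡ core x (B + 1ℚ) k * (rhs-num x K B * inv (rhs-den x K B))
rhs-term-suc n B k 1≤n bound = begin
  coeff x B * summand x (B + 1ℚ) (suc k)
    ≡⟨ cong (coeff x B *_) (term54-split _ _ _ _ _ _ _ _ _ (suc k)) ⟩
  coeff x B * ((poch (1ℚ - nℚ 2 * x * ⅓) (suc k) * inv (poch β (suc k))) * core x (B + 1ℚ) (suc k))
    ≡⟨ cong₂ (λ r c → coeff x B * (r * c)) (leading-ratio x (suc k) β+j≢0) (core-suc x B k) ⟩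
  coeff x B * (((β + nℚ (suc k)) * inv β) * (core x (B + 1ℚ) k * (ratio-num x K B * inv (ratio-den x K B))))
    ≡⟨ scaled-quotient-product (coeff x B) (β + nℚ (suc k)) β (core x (B + 1ℚ) k) (ratio-num x K B) (ratio-den x K B) ⟩
  core x (B + 1ℚ) k * ((coeff x B * (β + nℚ (suc k)) * ratio-num x K B) * inv (β * ratio-den x K B))
    ≡⟨ cong (λ t → core x (B + 1ℚ) k * ((coeff x B * (β + t) * ratio-num x K B) * inv (β * ratio-den x K B))) (nℚ-suc k) ⟩
  core x (B + 1ℚ) k * (rhs-num x K B * inv (rhs-den x K B))
    ∎
  where
  open ≡-Reasoning
  x = nℚ n
  K = nℚ k
  β = - (nℚ 2 * x * ⅓)
  β+j≢0 : ∀ j → j ≤ suc k → β + nℚ j ≢ 0ℚ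
  β+j≢0 j j≤1+k = leading-factor≢0 n j 1≤n (ℕP.≤-trans (ℕP.+-mono-≤ j≤1+k j≤1+k) bound)

cert-num : ℚ → ℚ → ℚ → ℚ
cert-num x K B = (K - x * ½) * (nℚ 2 * x + nℚ 2 * B + nℚ 2 + K)
  * (½ * (B + 1ℚ) * (B + nℚ 2) - K * (nℚ 2 * K + 1ℚ) + nℚ 3 * x * (1ℚ + B * ½ + K))

cert-den : ℚ → ℚ → ℚ → ℚ
cert-den x K B = x * (1ℚ + B * ½ + K) * (x + 1ℚ + B)

certificate : ℕ → ℚ → ℕ → ℚ
certificate n B zero = 0ℚ
certificate n B (suc k) = core (nℚ n) (B + 1ℚ) k * (cert-num (nℚ n) (nℚ k) B * inv (cert-den (nℚ n) (nℚ k) B))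

certificate-suc-suc : ∀ n B k → let x = nℚ n; K = nℚ k in
  certificate n B (suc (suc k))
  ≡ core x (B + 1ℚ) k * ((ratio-num x K B * cert-num x (K + 1ℚ) B) * inv (ratio-den x K B * cert-den x (K + 1ℚ) B))
certificate-suc-suc n B k = begin
  core x (B + 1ℚ) (suc k) * (cert-num x (nℚ (suc k)) B * inv (cert-den x (nℚ (suc k)) B))
    ≡⟨ cong₂ (λ c t → c * (cert-num x t B * inv (cert-den x t B))) (core-suc x B k) (nℚ-suc k) ⟩
  (core x (B + 1ℚ) k * (ratio-num x K B * inv (ratio-den x K B))) * (cert-num x (K + 1ℚ) B * inv (cert-den x (K + 1ℚ) B))
    ≡⟨ quotient-product (core x (B + 1ℚ) k) (ratio-num x K B) (ratio-den x K B) (cert-num x (K + 1ℚ) B) (cert-den x (K + 1ℚ) B) ⟩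
  core x (B + 1ℚ) k * ((ratio-num x K B * cert-num x (K + 1ℚ) B) * inv (ratio-den x K B * cert-den x (K + 1ℚ) B))
    ∎
  where
  open ≡-Reasoning
  x = nℚ n
  K = nℚ k

-- Cofactors bringing each fraction of a telescoping step to the common denominator
-- cert-den * cert-cof₀. At the last index of the sums (ᵉ for even n, ᵒ for odd n) the factors
-- of cert-cof₀ that may vanish there are dropped.
lhs-cof : ℚ → ℚ → ℚ → ℚ
lhs-cof x K B = nℚ 3 * ½ * (1ℚ - x + K) * (1ℚ + (B + 1ℚ) * ½ + K) * (1ℚ + B * ½ + (K + 1ℚ)) * (x + 1ℚ + B)

rhs-cof : ℚ → ℚ → ℚ → ℚ
rhs-cof x K B = - (nℚ 3 * ½) * (x + 1ℚ) * (½ + B * ½) * (1ℚ + B * ½ + (K + 1ℚ)) * (x + 1ℚ + B)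

cert-cof₁ : ℚ → ℚ → ℚ → ℚ
cert-cof₁ x K B = (x + 1ℚ) * (½ + B * ½)

cert-cof₀ : ℚ → ℚ → ℚ → ℚ
cert-cof₀ x K B = (x + 1ℚ) * (K + 1ℚ) * (1ℚ - x + K) * (½ + B * ½) * (1ℚ + (B + 1ℚ) * ½ + K) * (1ℚ + B * ½ + (K + 1ℚ))

lhs-cofᵉ : ℚ → ℚ → ℚ → ℚ
lhs-cofᵉ x K B = nℚ 3 * ½ * (1ℚ - x + K) * (1ℚ + (B + 1ℚ) * ½ + K) * (x + 1ℚ + B)

rhs-cofᵉ : ℚ → ℚ → ℚ → ℚ
rhs-cofᵉ x K B = - (nℚ 3 * ½) * (x + 1ℚ) * (½ + B * ½) * (x + 1ℚ + B)

cert-cofᵉ : ℚ → ℚ → ℚ → ℚ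
cert-cofᵉ x K B = (x + 1ℚ) * (K + 1ℚ) * (1ℚ - x + K) * (½ + B * ½) * (1ℚ + (B + 1ℚ) * ½ + K)

lhs-cofᵒ : ℚ → ℚ → ℚ → ℚ
lhs-cofᵒ x K B = nℚ 3 * ½ * (x + 1ℚ + B)

cert-cofᵒ : ℚ → ℚ → ℚ → ℚ
cert-cofᵒ x K B = (x + 1ℚ) * (K + 1ℚ) * (½ + B * ½)

-- The ring solver does not unfold definitions, so each identity is proved in unfolded form.
lhs-den-cofactor : ∀ x K B → lhs-den x K B * lhs-cof x K B ≡ cert-den x K B * cert-cof₀ x K B
lhs-den-cofactor = unfolded
  where
  unfolded : ∀ x K B →
    - (nℚ 2 * (x + 1ℚ) * ⅓)
    * ((K + 1ℚ) * (1ℚ - (x + 1ℚ)) * (½ + B * ½) * (1ℚ + B * ½ + K))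
    * (nℚ 3 * ½ * (1ℚ - x + K) * (1ℚ + (B + 1ℚ) * ½ + K) * (1ℚ + B * ½ + (K + 1ℚ)) * (x + 1ℚ + B))
    ≡
    x
    * (1ℚ + B * ½ + K)
    * (x + 1ℚ + B)
    * ((x + 1ℚ)
       * (K + 1ℚ)
       * (1ℚ - x + K)
       * (½ + B * ½)
       * (1ℚ + (B + 1ℚ) * ½ + K)
       * (1ℚ + B * ½ + (K + 1ℚ)))
  unfolded = solve-∀ ℚ-ring

rhs-den-cofactor : ∀ x K B → rhs-den x K B * rhs-cof x K B ≡ cert-den x K B * cert-cof₀ x K B
rhs-den-cofactor = unfolded
  where
  unfolded : ∀ x K B →
    - (nℚ 2 * x * ⅓)
    * ((K + 1ℚ) * (1ℚ - x + K) * (½ + (B + 1ℚ) * ½ + K) * (1ℚ + (B + 1ℚ) * ½ + K))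
    * (- (nℚ 3 * ½) * (x + 1ℚ) * (½ + B * ½) * (1ℚ + B * ½ + (K + 1ℚ)) * (x + 1ℚ + B))
    ≡
    x
    * (1ℚ + B * ½ + K)
    * (x + 1ℚ + B)
    * ((x + 1ℚ)
       * (K + 1ℚ)
       * (1ℚ - x + K)
       * (½ + B * ½)
       * (1ℚ + (B + 1ℚ) * ½ + K)
       * (1ℚ + B * ½ + (K + 1ℚ)))
  unfolded = solve-∀ ℚ-ring

cert-den-cofactor : ∀ x K B →
  ratio-den x K B * cert-den x (K + 1ℚ) B * cert-cof₁ x K B
  ≡ cert-den x K B * cert-cof₀ x K B
cert-den-cofactor = unfolded
  where
  unfolded : ∀ x K B →
    (K + 1ℚ)
    * (1ℚ - x + K)
    * (½ + (B + 1ℚ) * ½ + K)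
    * (1ℚ + (B + 1ℚ) * ½ + K)
    * (x * (1ℚ + B * ½ + (K + 1ℚ)) * (x + 1ℚ + B))
    * ((x + 1ℚ) * (½ + B * ½))
    ≡
    x
    * (1ℚ + B * ½ + K)
    * (x + 1ℚ + B)
    * ((x + 1ℚ)
       * (K + 1ℚ)
       * (1ℚ - x + K)
       * (½ + B * ½)
       * (1ℚ + (B + 1ℚ) * ½ + K)
       * (1ℚ + B * ½ + (K + 1ℚ)))
  unfolded = solve-∀ ℚ-ring

wz-identity : ∀ x K B →
  lhs-num x K B * lhs-cof x K B - rhs-num x K B * rhs-cof x K B
  ≡ ratio-num x K B * cert-num x (K + 1ℚ) B * cert-cof₁ x K B - cert-num x K B * cert-cof₀ x K B
wz-identity = unfolded
  where
  unfolded : ∀ x K B →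
    (1ℚ + B)
    * (- (nℚ 2 * (x + 1ℚ) * ⅓) + (K + 1ℚ))
    * (- ((x + 1ℚ) * ½)
       * (½ - (x + 1ℚ) * ½ + K)
       * (- (nℚ 2 * (x + 1ℚ)) - B)
       * (nℚ 2 * (x + 1ℚ) + nℚ 2 * B + K))
    * (nℚ 3 * ½ * (1ℚ - x + K) * (1ℚ + (B + 1ℚ) * ½ + K) * (1ℚ + B * ½ + (K + 1ℚ)) * (x + 1ℚ + B))
    - (nℚ 3 * x + nℚ 2 * B + nℚ 2)
      * (- (nℚ 2 * x * ⅓) + (K + 1ℚ))
      * ((- (x * ½) + K)
         * (½ - x * ½ + K)
         * (- (nℚ 2 * x) - (B + 1ℚ) + K)
         * (nℚ 2 * x + nℚ 2 * (B + 1ℚ) + K))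
      * (- (nℚ 3 * ½) * (x + 1ℚ) * (½ + B * ½) * (1ℚ + B * ½ + (K + 1ℚ)) * (x + 1ℚ + B))
    ≡
    (- (x * ½) + K)
    * (½ - x * ½ + K)
    * (- (nℚ 2 * x) - (B + 1ℚ) + K)
    * (nℚ 2 * x + nℚ 2 * (B + 1ℚ) + K)
    * ((K + 1ℚ - x * ½)
       * (nℚ 2 * x + nℚ 2 * B + nℚ 2 + (K + 1ℚ))
       * (½ * (B + 1ℚ) * (B + nℚ 2)
          - (K + 1ℚ) * (nℚ 2 * (K + 1ℚ) + 1ℚ)
          + nℚ 3 * x * (1ℚ + B * ½ + (K + 1ℚ))))
    * ((x + 1ℚ) * (½ + B * ½))
    - (K - x * ½)
      * (nℚ 2 * x + nℚ 2 * B + nℚ 2 + K)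
      * (½ * (B + 1ℚ) * (B + nℚ 2) - K * (nℚ 2 * K + 1ℚ) + nℚ 3 * x * (1ℚ + B * ½ + K))
      * ((x + 1ℚ)
         * (K + 1ℚ)
         * (1ℚ - x + K)
         * (½ + B * ½)
         * (1ℚ + (B + 1ℚ) * ½ + K)
         * (1ℚ + B * ½ + (K + 1ℚ)))
  unfolded = solve-∀ ℚ-ring

lhs-den-cofactorᵉ : ∀ x K B → lhs-den x K B * lhs-cofᵉ x K B ≡ cert-den x K B * cert-cofᵉ x K B
lhs-den-cofactorᵉ = unfolded
  where
  unfolded : ∀ x K B →
    - (nℚ 2 * (x + 1ℚ) * ⅓)
    * ((K + 1ℚ) * (1ℚ - (x + 1ℚ)) * (½ + B * ½) * (1ℚ + B * ½ + K))
    * (nℚ 3 * ½ * (1ℚ - x + K) * (1ℚ + (B + 1ℚ) * ½ + K) * (x + 1ℚ + B))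
    ≡
    x
    * (1ℚ + B * ½ + K)
    * (x + 1ℚ + B)
    * ((x + 1ℚ) * (K + 1ℚ) * (1ℚ - x + K) * (½ + B * ½) * (1ℚ + (B + 1ℚ) * ½ + K))
  unfolded = solve-∀ ℚ-ring

rhs-den-cofactorᵉ : ∀ x K B → rhs-den x K B * rhs-cofᵉ x K B ≡ cert-den x K B * cert-cofᵉ x K B
rhs-den-cofactorᵉ = unfolded
  where
  unfolded : ∀ x K B →
    - (nℚ 2 * x * ⅓)
    * ((K + 1ℚ) * (1ℚ - x + K) * (½ + (B + 1ℚ) * ½ + K) * (1ℚ + (B + 1ℚ) * ½ + K))
    * (- (nℚ 3 * ½) * (x + 1ℚ) * (½ + B * ½) * (x + 1ℚ + B))
    ≡
    x
    * (1ℚ + B * ½ + K)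
    * (x + 1ℚ + B)
    * ((x + 1ℚ) * (K + 1ℚ) * (1ℚ - x + K) * (½ + B * ½) * (1ℚ + (B + 1ℚ) * ½ + K))
  unfolded = solve-∀ ℚ-ring

wz-identityᵉ : ∀ K B → let x = nℚ 2 * K + nℚ 2 in
  lhs-num x K B * lhs-cofᵉ x K B - rhs-num x K B * rhs-cofᵉ x K B + cert-num x K B * cert-cofᵉ x K B ≡ 0ℚ
wz-identityᵉ = unfolded
  where
  unfolded : ∀ K B →
    (1ℚ + B)
    * (- (nℚ 2 * (nℚ 2 * K + nℚ 2 + 1ℚ) * ⅓) + (K + 1ℚ))
    * (- ((nℚ 2 * K + nℚ 2 + 1ℚ) * ½)
       * (½ - (nℚ 2 * K + nℚ 2 + 1ℚ) * ½ + K)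
       * (- (nℚ 2 * (nℚ 2 * K + nℚ 2 + 1ℚ)) - B)
       * (nℚ 2 * (nℚ 2 * K + nℚ 2 + 1ℚ) + nℚ 2 * B + K))
    * (nℚ 3
       * ½
       * (1ℚ - (nℚ 2 * K + nℚ 2) + K)
       * (1ℚ + (B + 1ℚ) * ½ + K)
       * (nℚ 2 * K + nℚ 2 + 1ℚ + B))
    - (nℚ 3 * (nℚ 2 * K + nℚ 2) + nℚ 2 * B + nℚ 2)
      * (- (nℚ 2 * (nℚ 2 * K + nℚ 2) * ⅓) + (K + 1ℚ))
      * ((- ((nℚ 2 * K + nℚ 2) * ½) + K)
         * (½ - (nℚ 2 * K + nℚ 2) * ½ + K)
         * (- (nℚ 2 * (nℚ 2 * K + nℚ 2)) - (B + 1ℚ) + K)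
         * (nℚ 2 * (nℚ 2 * K + nℚ 2) + nℚ 2 * (B + 1ℚ) + K))
      * (- (nℚ 3 * ½) * (nℚ 2 * K + nℚ 2 + 1ℚ) * (½ + B * ½) * (nℚ 2 * K + nℚ 2 + 1ℚ + B))
    + (K - (nℚ 2 * K + nℚ 2) * ½)
      * (nℚ 2 * (nℚ 2 * K + nℚ 2) + nℚ 2 * B + nℚ 2 + K)
      * (½ * (B + 1ℚ) * (B + nℚ 2)
         - K * (nℚ 2 * K + 1ℚ)
         + nℚ 3 * (nℚ 2 * K + nℚ 2) * (1ℚ + B * ½ + K))
      * ((nℚ 2 * K + nℚ 2 + 1ℚ)
         * (K + 1ℚ)
         * (1ℚ - (nℚ 2 * K + nℚ 2) + K)
         * (½ + B * ½)
         * (1ℚ + (B + 1ℚ) * ½ + K))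
    ≡
    0ℚ
  unfolded = solve-∀ ℚ-ring

lhs-den-cofactorᵒ : ∀ x K B → lhs-den x K B * lhs-cofᵒ x K B ≡ cert-den x K B * cert-cofᵒ x K B
lhs-den-cofactorᵒ = unfolded
  where
  unfolded : ∀ x K B →
    - (nℚ 2 * (x + 1ℚ) * ⅓)
    * ((K + 1ℚ) * (1ℚ - (x + 1ℚ)) * (½ + B * ½) * (1ℚ + B * ½ + K))
    * (nℚ 3 * ½ * (x + 1ℚ + B))
    ≡
    x * (1ℚ + B * ½ + K) * (x + 1ℚ + B) * ((x + 1ℚ) * (K + 1ℚ) * (½ + B * ½))
  unfolded = solve-∀ ℚ-ring

wz-identityᵒ : ∀ K B → let x = nℚ 2 * K + 1ℚ in
  lhs-num x K B * lhs-cofᵒ x K B + cert-num x K B * cert-cofᵒ x K B ≡ 0ℚ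
wz-identityᵒ = unfolded
  where
  unfolded : ∀ K B →
    (1ℚ + B)
    * (- (nℚ 2 * (nℚ 2 * K + 1ℚ + 1ℚ) * ⅓) + (K + 1ℚ))
    * (- ((nℚ 2 * K + 1ℚ + 1ℚ) * ½)
       * (½ - (nℚ 2 * K + 1ℚ + 1ℚ) * ½ + K)
       * (- (nℚ 2 * (nℚ 2 * K + 1ℚ + 1ℚ)) - B)
       * (nℚ 2 * (nℚ 2 * K + 1ℚ + 1ℚ) + nℚ 2 * B + K))
    * (nℚ 3 * ½ * (nℚ 2 * K + 1ℚ + 1ℚ + B))
    + (K - (nℚ 2 * K + 1ℚ) * ½)
      * (nℚ 2 * (nℚ 2 * K + 1ℚ) + nℚ 2 * B + nℚ 2 + K)
      * (½ * (B + 1ℚ) * (B + nℚ 2)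
         - K * (nℚ 2 * K + 1ℚ)
         + nℚ 3 * (nℚ 2 * K + 1ℚ) * (1ℚ + B * ½ + K))
      * ((nℚ 2 * K + 1ℚ + 1ℚ) * (K + 1ℚ) * (½ + B * ½))
    ≡
    0ℚ
  unfolded = solve-∀ ℚ-ring

wz-identity-start : ∀ x B → cert-num x 0ℚ B ≡ - (nℚ 3 * x + B + 1ℚ) * cert-den x 0ℚ B
wz-identity-start = unfolded
  where
  unfolded : ∀ x B →
    (0ℚ - x * ½)
    * (nℚ 2 * x + nℚ 2 * B + nℚ 2 + 0ℚ)
    * (½ * (B + 1ℚ) * (B + nℚ 2) - 0ℚ * (nℚ 2 * 0ℚ + 1ℚ) + nℚ 3 * x * (1ℚ + B * ½ + 0ℚ))
    ≡
    - (nℚ 3 * x + B + 1ℚ) * (x * (1ℚ + B * ½ + 0ℚ) * (x + 1ℚ + B))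
  unfolded = solve-∀ ℚ-ring

-- f₀, f₁, f₂ and f₃ are (1 + B + i)/2 for i = 0, 2k + 1, 2k + 2 and 2k + 3, fₙ is 1 + B + n,
-- and L is 1 - n + k.
module Nonvanishing (n : ℕ) (B : ℚ) (hyp : ∀ i → i ≤ n → 1ℚ + B + nℚ i ≢ 0ℚ) where

  private
    x = nℚ n

  half-shifted≢0 : ∀ i → i ≤ n → ∀ {q} → q ≡ ½ * (1ℚ + B + nℚ i) → q ≢ 0ℚ
  half-shifted≢0 i i≤n refl = *≢0 {½} (λ ()) (hyp i i≤n)

  f₀≢0 : ½ + B * ½ ≢ 0ℚ
  f₀≢0 = half-shifted≢0 0 z≤n (as-half B)
    where
    as-half : ∀ B → ½ + B * ½ ≡ ½ * (1ℚ + B + 0ℚ)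
    as-half = solve-∀ ℚ-ring

  f₁≢0 : ∀ k → suc (k ℕ.+ k) ≤ n → 1ℚ + B * ½ + nℚ k ≢ 0ℚ
  f₁≢0 k bound = half-shifted≢0 (suc (k ℕ.+ k)) bound
    (trans (as-half B (nℚ k)) (cong (λ t → ½ * (1ℚ + B + t)) (sym (nℚ-2k+1 k))))
    where
    as-half : ∀ B K → 1ℚ + B * ½ + K ≡ ½ * (1ℚ + B + (K + K + 1ℚ))
    as-half = solve-∀ ℚ-ring

  f₂≢0 : ∀ k → suc (suc (k ℕ.+ k)) ≤ n → 1ℚ + (B + 1ℚ) * ½ + nℚ k ≢ 0ℚ
  f₂≢0 k bound = half-shifted≢0 (suc (suc (k ℕ.+ k))) bound
    (trans (as-half B (nℚ k)) (cong (λ t → ½ * (1ℚ + B + t)) (sym (trans (nℚ-suc (suc (k ℕ.+ k))) (cong (_+ 1ℚ) (nℚ-2k+1 k))))))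
    where
    as-half : ∀ B K → 1ℚ + (B + 1ℚ) * ½ + K ≡ ½ * (1ℚ + B + (K + K + 1ℚ + 1ℚ))
    as-half = solve-∀ ℚ-ring

  f₃≢0 : ∀ k → suc (suc (suc (k ℕ.+ k))) ≤ n → 1ℚ + B * ½ + (nℚ k + 1ℚ) ≢ 0ℚ
  f₃≢0 k bound = subst (λ t → 1ℚ + B * ½ + t ≢ 0ℚ) (nℚ-suc k)
    (f₁≢0 (suc k) (subst (_≤ n) (cong (λ t → suc (suc t)) (sym (ℕP.+-suc k k))) bound))

  fₙ≢0 : x + 1ℚ + B ≢ 0ℚ
  fₙ≢0 = subst (_≢ 0ℚ) (swap B x) (hyp n ℕP.≤-refl)
    where
    swap : ∀ B x → 1ℚ + B + x ≡ x + 1ℚ + B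
    swap = solve-∀ ℚ-ring

  L≢0 : ∀ k → suc (suc (k ℕ.+ k)) ≤ n → 1ℚ - x + nℚ k ≢ 0ℚ
  L≢0 k bound = subst (_≢ 0ℚ) (regroup (nℚ k) x) (subst (λ t → t - x ≢ 0ℚ) (nℚ-suc k) (nℚ-≢ 1+k≢n))
    where
    regroup : ∀ K x → K + 1ℚ - x ≡ 1ℚ - x + K
    regroup = solve-∀ ℚ-ring
    1+k≢n : suc k ≢ n
    1+k≢n refl = ℕP.<-irrefl refl (ℕP.≤-trans (s≤s (s≤s (ℕP.m≤m+n k k))) bound)

  cert-den₀≢0 : 1 ≤ n → cert-den x 0ℚ B ≢ 0ℚ
  cert-den₀≢0 1≤n = *≢0 (*≢0 x≢0 (f₁≢0 0 1≤n)) fₙ≢0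
    where
    x≢0 : x ≢ 0ℚ
    x≢0 eq = ℕP.<⇒≢ 1≤n (sym (nℚ-injective {n} {0} eq))

  module _ (k : ℕ) where
    private
      K = nℚ k

    lhs-cofᵉ≢0 : suc (suc (k ℕ.+ k)) ≤ n → lhs-cofᵉ x K B ≢ 0ℚ
    lhs-cofᵉ≢0 bound = *≢0 (*≢0 (*≢0 {nℚ 3 * ½} (λ ()) (L≢0 k bound)) (f₂≢0 k bound)) fₙ≢0

    rhs-cofᵉ≢0 : rhs-cofᵉ x K B ≢ 0ℚ
    rhs-cofᵉ≢0 = *≢0 (*≢0 (*≢0 { - (nℚ 3 * ½)} (λ ()) (nℚ-suc≢0 n)) f₀≢0) fₙ≢0

    cert-cofᵉ≢0 : suc (suc (k ℕ.+ k)) ≤ n → cert-cofᵉ x K B ≢ 0ℚ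
    cert-cofᵉ≢0 bound = *≢0 (*≢0 (*≢0 (*≢0 (nℚ-suc≢0 n) (nℚ-suc≢0 k)) (L≢0 k bound)) f₀≢0) (f₂≢0 k bound)

    lhs-cof≢0 : suc (suc (suc (k ℕ.+ k))) ≤ n → lhs-cof x K B ≢ 0ℚ
    lhs-cof≢0 bound = *≢0 (*≢0 (*≢0 (*≢0 {nℚ 3 * ½} (λ ()) (L≢0 k bound′)) (f₂≢0 k bound′)) (f₃≢0 k bound)) fₙ≢0
      where bound′ = ℕP.≤-trans (ℕP.n≤1+n _) bound

    rhs-cof≢0 : suc (suc (suc (k ℕ.+ k))) ≤ n → rhs-cof x K B ≢ 0ℚ
    rhs-cof≢0 bound = *≢0 (*≢0 (*≢0 (*≢0 { - (nℚ 3 * ½)} (λ ()) (nℚ-suc≢0 n)) f₀≢0) (f₃≢0 k bound)) fₙ≢0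

    cert-cof₁≢0 : cert-cof₁ x K B ≢ 0ℚ
    cert-cof₁≢0 = *≢0 (nℚ-suc≢0 n) f₀≢0

    cert-cof₀≢0 : suc (suc (suc (k ℕ.+ k))) ≤ n → cert-cof₀ x K B ≢ 0ℚ
    cert-cof₀≢0 bound = *≢0 (cert-cofᵉ≢0 bound′) (f₃≢0 k bound)
      where bound′ = ℕP.≤-trans (ℕP.n≤1+n _) bound

    lhs-cofᵒ≢0 : lhs-cofᵒ x K B ≢ 0ℚ
    lhs-cofᵒ≢0 = *≢0 {nℚ 3 * ½} (λ ()) fₙ≢0

    cert-cofᵒ≢0 : cert-cofᵒ x K B ≢ 0ℚ
    cert-cofᵒ≢0 = *≢0 (*≢0 (nℚ-suc≢0 n) (nℚ-suc≢0 k)) f₀≢0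

2[1+k]≡2+2k : ∀ k → suc k ℕ.+ suc k ≡ suc (suc (k ℕ.+ k))
2[1+k]≡2+2k k = cong suc (ℕP.+-suc k k)

wz-start : ∀ n B → 1 ≤ n → (∀ i → i ≤ n → 1ℚ + B + nℚ i ≢ 0ℚ) →
  lhs-term n B 0 - rhs-term n B 0 ≡ certificate n B 1 - certificate n B 0
wz-start n B 1≤n hyp = begin
  -- the terms of index 0 and core at 0 compute to 1ℚ
  (1ℚ + B) * 1ℚ - coeff x B * 1ℚ
    ≡⟨ difference x B ⟩
  c
    ≡⟨ *-inv-cancelʳ c (cert-den₀≢0 1≤n) ⟨
  (c * cert-den x 0ℚ B) * inv (cert-den x 0ℚ B)
    ≡⟨ cong (_* inv (cert-den x 0ℚ B)) (wz-identity-start x B) ⟨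
  cert-num x 0ℚ B * inv (cert-den x 0ℚ B)
    ≡⟨ pad (cert-num x 0ℚ B * inv (cert-den x 0ℚ B)) ⟩
  1ℚ * (cert-num x 0ℚ B * inv (cert-den x 0ℚ B)) - 0ℚ
    ∎
  where
  open ≡-Reasoning
  open Nonvanishing n B hyp
  x = nℚ n
  c = - (nℚ 3 * x + B + 1ℚ)
  difference : ∀ x B → (1ℚ + B) * 1ℚ - (nℚ 3 * x + nℚ 2 * B + nℚ 2) * 1ℚ ≡ - (nℚ 3 * x + B + 1ℚ)
  difference = solve-∀ ℚ-ring
  pad : ∀ t → t ≡ 1ℚ * t - 0ℚ
  pad = solve-∀ ℚ-ring

wz-step : ∀ n B k → (∀ i → i ≤ n → 1ℚ + B + nℚ i ≢ 0ℚ) → suc (suc (suc (k ℕ.+ k))) ≤ n →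
  lhs-term n B (suc k) - rhs-term n B (suc k) ≡ certificate n B (suc (suc k)) - certificate n B (suc k)
wz-step n B k hyp bound = begin
  lhs-term n B (suc k) - rhs-term n B (suc k)
    ≡⟨ cong₂ _-_ (lhs-term-suc n B k lhs-bound) (rhs-term-suc n B k 1≤n rhs-bound) ⟩
  U * (lhs-num x K B * inv (lhs-den x K B)) - U * (rhs-num x K B * inv (rhs-den x K B))
    ≡⟨ cong₂ _-_ (over-common-denominator U (lhs-num x K B) (lhs-den x K B) (lhs-den-cofactor x K B) (lhs-cof≢0 k bound))
                 (over-common-denominator U (rhs-num x K B) (rhs-den x K B) (rhs-den-cofactor x K B) (rhs-cof≢0 k bound)) ⟩
  W * (lhs-num x K B * lhs-cof x K B) - W * (rhs-num x K B * rhs-cof x K B)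
    ≡⟨ scale-difference W (wz-identity x K B) ⟩
  W * (ratio-num x K B * cert-num x (K + 1ℚ) B * cert-cof₁ x K B) - W * (cert-num x K B * cert-cof₀ x K B)
    ≡⟨ cong₂ _-_ (over-common-denominator U (ratio-num x K B * cert-num x (K + 1ℚ) B) (ratio-den x K B * cert-den x (K + 1ℚ) B)
                   (cert-den-cofactor x K B) (cert-cof₁≢0 k))
                 (over-common-denominator U (cert-num x K B) (cert-den x K B) refl (cert-cof₀≢0 k bound)) ⟨
  U * ((ratio-num x K B * cert-num x (K + 1ℚ) B) * inv (ratio-den x K B * cert-den x (K + 1ℚ) B))
    - U * (cert-num x K B * inv (cert-den x K B))
    ≡⟨ cong (_- certificate n B (suc k)) (certificate-suc-suc n B k) ⟨
  certificate n B (suc (suc k)) - certificate n B (suc k)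
    ∎
  where
  open ≡-Reasoning
  open Nonvanishing n B hyp
  x = nℚ n
  K = nℚ k
  U = core x (B + 1ℚ) k
  W = U * inv (cert-den x K B * cert-cof₀ x K B)
  1≤n : 1 ≤ n
  1≤n = ℕP.≤-trans (s≤s z≤n) bound
  rhs-bound : suc k ℕ.+ suc k ≤ n
  rhs-bound = subst (_≤ n) (sym (2[1+k]≡2+2k k)) (ℕP.≤-trans (ℕP.n≤1+n _) bound)
  lhs-bound : suc k ℕ.+ suc k ≤ suc n
  lhs-bound = ℕP.m≤n⇒m≤1+n rhs-bound

wz-end-even : ∀ j B → let n = suc (suc (j ℕ.+ j)) in (∀ i → i ≤ n → 1ℚ + B + nℚ i ≢ 0ℚ) →
  lhs-term n B (suc j) - rhs-term n B (suc j) + certificate n B (suc j) ≡ 0ℚ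
wz-end-even j B hyp = begin
  lhs-term n B (suc j) - rhs-term n B (suc j) + certificate n B (suc j)
    ≡⟨ cong₂ (λ p q → p - q + certificate n B (suc j)) (lhs-term-suc n B j lhs-bound) (rhs-term-suc n B j (s≤s z≤n) rhs-bound) ⟩
  U * (lhs-num x K B * inv (lhs-den x K B)) - U * (rhs-num x K B * inv (rhs-den x K B)) + U * (cert-num x K B * inv (cert-den x K B))
    ≡⟨ cong₂ _+_ (cong₂ _-_ (over-common-denominator U (lhs-num x K B) (lhs-den x K B) (lhs-den-cofactorᵉ x K B) (lhs-cofᵉ≢0 j ℕP.≤-refl))
                            (over-common-denominator U (rhs-num x K B) (rhs-den x K B) (rhs-den-cofactorᵉ x K B) (rhs-cofᵉ≢0 j)))
                 (over-common-denominator U (cert-num x K B) (cert-den x K B) refl (cert-cofᵉ≢0 j ℕP.≤-refl)) ⟩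
  W * (lhs-num x K B * lhs-cofᵉ x K B) - W * (rhs-num x K B * rhs-cofᵉ x K B) + W * (cert-num x K B * cert-cofᵉ x K B)
    ≡⟨ factor W _ _ _ ⟩
  W * (lhs-num x K B * lhs-cofᵉ x K B - rhs-num x K B * rhs-cofᵉ x K B + cert-num x K B * cert-cofᵉ x K B)
    ≡⟨ cong (W *_) (subst (λ z → lhs-num z K B * lhs-cofᵉ z K B - rhs-num z K B * rhs-cofᵉ z K B + cert-num z K B * cert-cofᵉ z K B ≡ 0ℚ)
                          (sym x≡2K+2) (wz-identityᵉ K B)) ⟩
  W * 0ℚ
    ≡⟨ ℚP.*-zeroʳ W ⟩
  0ℚ
    ∎
  where
  open ≡-Reasoning
  open Nonvanishing (suc (suc (j ℕ.+ j))) B hyp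
  n = suc (suc (j ℕ.+ j))
  x = nℚ n
  K = nℚ j
  U = core x (B + 1ℚ) j
  W = U * inv (cert-den x K B * cert-cofᵉ x K B)
  factor : ∀ W X Y Z → W * X - W * Y + W * Z ≡ W * (X - Y + Z)
  factor = solve-∀ ℚ-ring
  x≡2K+2 : x ≡ nℚ 2 * K + nℚ 2
  x≡2K+2 = trans (nℚ-suc (suc (j ℕ.+ j))) (trans (cong (_+ 1ℚ) (nℚ-2k+1 j)) (double K))
    where
    double : ∀ K → K + K + 1ℚ + 1ℚ ≡ nℚ 2 * K + nℚ 2
    double = solve-∀ ℚ-ring
  rhs-bound : suc j ℕ.+ suc j ≤ n
  rhs-bound = ℕP.≤-reflexive (2[1+k]≡2+2k j)
  lhs-bound : suc j ℕ.+ suc j ≤ suc n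
  lhs-bound = ℕP.m≤n⇒m≤1+n rhs-bound

wz-end-odd : ∀ j B → let n = suc (j ℕ.+ j) in (∀ i → i ≤ n → 1ℚ + B + nℚ i ≢ 0ℚ) →
  lhs-term n B (suc j) + certificate n B (suc j) ≡ 0ℚ
wz-end-odd j B hyp = begin
  lhs-term n B (suc j) + certificate n B (suc j)
    ≡⟨ cong (_+ certificate n B (suc j)) (lhs-term-suc n B j lhs-bound) ⟩
  U * (lhs-num x K B * inv (lhs-den x K B)) + U * (cert-num x K B * inv (cert-den x K B))
    ≡⟨ cong₂ _+_ (over-common-denominator U (lhs-num x K B) (lhs-den x K B) (lhs-den-cofactorᵒ x K B) (lhs-cofᵒ≢0 j))
                 (over-common-denominator U (cert-num x K B) (cert-den x K B) refl (cert-cofᵒ≢0 j)) ⟩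
  W * (lhs-num x K B * lhs-cofᵒ x K B) + W * (cert-num x K B * cert-cofᵒ x K B)
    ≡⟨ ℚP.*-distribˡ-+ W _ _ ⟨
  W * (lhs-num x K B * lhs-cofᵒ x K B + cert-num x K B * cert-cofᵒ x K B)
    ≡⟨ cong (W *_) (subst (λ z → lhs-num z K B * lhs-cofᵒ z K B + cert-num z K B * cert-cofᵒ z K B ≡ 0ℚ)
                          (sym x≡2K+1) (wz-identityᵒ K B)) ⟩
  W * 0ℚ
    ≡⟨ ℚP.*-zeroʳ W ⟩
  0ℚ
    ∎
  where
  open ≡-Reasoning
  open Nonvanishing (suc (j ℕ.+ j)) B hyp
  n = suc (j ℕ.+ j)
  x = nℚ n
  K = nℚ j
  U = core x (B + 1ℚ) j
  W = U * inv (cert-den x K B * cert-cofᵒ x K B)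
  x≡2K+1 : x ≡ nℚ 2 * K + 1ℚ
  x≡2K+1 = trans (nℚ-2k+1 j) (double K)
    where
    double : ∀ K → K + K + 1ℚ ≡ nℚ 2 * K + 1ℚ
    double = solve-∀ ℚ-ring
  lhs-bound : suc j ℕ.+ suc j ≤ suc n
  lhs-bound = ℕP.≤-reflexive (2[1+k]≡2+2k j)

telescoped : ∀ n B → 1 ≤ n → (∀ i → i ≤ n → 1ℚ + B + nℚ i ≢ 0ℚ) → ∀ m → suc (m ℕ.+ m) ≤ n →
  sumTo m (lhs-term n B) - sumTo m (rhs-term n B) ≡ certificate n B (suc m)
telescoped n B 1≤n hyp m bound =
  trans (sumTo-telescope (lhs-term n B) (rhs-term n B) (certificate n B) m step) (ℚP.+-identityʳ _)
  where
  step : ∀ k → k ≤ m → lhs-term n B k - rhs-term n B k ≡ certificate n B (suc k) - certificate n B k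
  step zero _ = wz-start n B 1≤n hyp
  step (suc k) 1+k≤m = wz-step n B k hyp
    (ℕP.≤-trans (s≤s (subst (_≤ m ℕ.+ m) (2[1+k]≡2+2k k) (ℕP.+-mono-≤ 1+k≤m 1+k≤m))) bound)

sums-agree-even : ∀ j B → let n = suc (suc (j ℕ.+ j)) in (∀ i → i ≤ n → 1ℚ + B + nℚ i ≢ 0ℚ) →
  sumTo (suc j) (lhs-term n B) ≡ sumTo (suc j) (rhs-term n B)
sums-agree-even j B hyp = x∙y⁻¹≈ε⇒x≈y _ _ (begin
  (sumTo j L + L (suc j)) - (sumTo j R + R (suc j))
    ≡⟨ [a+b]-[c+d]≡[a-c]+[b-d] (sumTo j L) (L (suc j)) (sumTo j R) (R (suc j)) ⟩
  (sumTo j L - sumTo j R) + (L (suc j) - R (suc j))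
    ≡⟨ cong (_+ (L (suc j) - R (suc j))) (telescoped n B (s≤s z≤n) hyp j (ℕP.n≤1+n _)) ⟩
  certificate n B (suc j) + (L (suc j) - R (suc j))
    ≡⟨ ℚP.+-comm (certificate n B (suc j)) (L (suc j) - R (suc j)) ⟩
  L (suc j) - R (suc j) + certificate n B (suc j)
    ≡⟨ wz-end-even j B hyp ⟩
  0ℚ
    ∎)
  where
  open ≡-Reasoning
  n = suc (suc (j ℕ.+ j))
  L = lhs-term n B
  R = rhs-term n B

sums-agree-odd : ∀ j B → let n = suc (j ℕ.+ j) in (∀ i → i ≤ n → 1ℚ + B + nℚ i ≢ 0ℚ) →
  sumTo (suc j) (lhs-term n B) ≡ sumTo j (rhs-term n B)
sums-agree-odd j B hyp = x∙y⁻¹≈ε⇒x≈y _ _ (begin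
  (sumTo j L + L (suc j)) - sumTo j R        ≡⟨ swap (sumTo j L) (L (suc j)) (sumTo j R) ⟩
  (sumTo j L - sumTo j R) + L (suc j)        ≡⟨ cong (_+ L (suc j)) (telescoped n B (s≤s z≤n) hyp j ℕP.≤-refl) ⟩
  certificate n B (suc j) + L (suc j)        ≡⟨ ℚP.+-comm (certificate n B (suc j)) (L (suc j)) ⟩
  L (suc j) + certificate n B (suc j)        ≡⟨ wz-end-odd j B hyp ⟩
  0ℚ                                         ∎)
  where
  open ≡-Reasoning
  n = suc (j ℕ.+ j)
  L = lhs-term n B
  R = rhs-term n B
  swap : ∀ a b c → (a + b) - c ≡ (a - c) + b
  swap = solve-∀ ℚ-ring

even-or-odd : ∀ n → 1 ≤ n → (∃[ j ] n ≡ suc (suc (j ℕ.+ j))) ⊎ (∃[ j ] n ≡ suc (j ℕ.+ j))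
even-or-odd (suc zero) _ = inj₂ (0 , refl)
even-or-odd (suc (suc zero)) _ = inj₁ (0 , refl)
even-or-odd (suc (suc (suc m))) _ with even-or-odd (suc m) (s≤s z≤n)
... | inj₁ (j , refl) = inj₁ (suc j , cong (λ t → suc (suc (suc t))) (sym (ℕP.+-suc j j)))
... | inj₂ (j , refl) = inj₂ (suc j , cong (λ t → suc (suc t)) (sym (ℕP.+-suc j j)))

suc-suc/2 : ∀ m → suc (suc m) ℕD./ 2 ≡ suc (m ℕD./ 2)
suc-suc/2 m = ℕD.m/n≡1+[m∸n]/n {suc (suc m)} {2} (s≤s (s≤s z≤n))

double/2 : ∀ j → (j ℕ.+ j) ℕD./ 2 ≡ j
double/2 zero = refl
double/2 (suc j) = trans (cong (λ t → suc t ℕD./ 2) (ℕP.+-suc j j)) (trans (suc-suc/2 (j ℕ.+ j)) (cong suc (double/2 j)))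

suc-double/2 : ∀ j → suc (j ℕ.+ j) ℕD./ 2 ≡ j
suc-double/2 zero = refl
suc-double/2 (suc j) = trans (cong (λ t → suc (suc t) ℕD./ 2) (ℕP.+-suc j j)) (trans (suc-suc/2 (suc (j ℕ.+ j))) (cong suc (suc-double/2 j)))

sums-agree : ∀ n B → 1 ≤ n → (∀ i → i ≤ n → 1ℚ + B + nℚ i ≢ 0ℚ) →
  sumTo (suc n ℕD./ 2) (lhs-term n B) ≡ sumTo (n ℕD./ 2) (rhs-term n B)
sums-agree n B 1≤n = [ even , odd ]′ (even-or-odd n 1≤n)
  where
  open ≡-Reasoning
  SumsAgree : ℕ → Set
  SumsAgree m = (∀ i → i ≤ m → 1ℚ + B + nℚ i ≢ 0ℚ) →
    sumTo (suc m ℕD./ 2) (lhs-term m B) ≡ sumTo (m ℕD./ 2) (rhs-term m B)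
  even : ∃[ j ] n ≡ suc (suc (j ℕ.+ j)) → SumsAgree n
  even (j , n≡2j+2) = subst SumsAgree (sym n≡2j+2) (λ hyp → begin
    sumTo (suc m ℕD./ 2) (lhs-term m B)  ≡⟨ cong (λ t → sumTo t (lhs-term m B)) (trans (suc-suc/2 (suc (j ℕ.+ j))) (cong suc (suc-double/2 j))) ⟩
    sumTo (suc j) (lhs-term m B)         ≡⟨ sums-agree-even j B hyp ⟩
    sumTo (suc j) (rhs-term m B)         ≡⟨ cong (λ t → sumTo t (rhs-term m B)) (trans (suc-suc/2 (j ℕ.+ j)) (cong suc (double/2 j))) ⟨
    sumTo (m ℕD./ 2) (rhs-term m B)      ∎)
    where m = suc (suc (j ℕ.+ j))
  odd : ∃[ j ] n ≡ suc (j ℕ.+ j) → SumsAgree n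
  odd (j , n≡2j+1) = subst SumsAgree (sym n≡2j+1) (λ hyp → begin
    sumTo (suc m ℕD./ 2) (lhs-term m B)  ≡⟨ cong (λ t → sumTo t (lhs-term m B)) (trans (suc-suc/2 (j ℕ.+ j)) (cong suc (double/2 j))) ⟩
    sumTo (suc j) (lhs-term m B)         ≡⟨ sums-agree-odd j B hyp ⟩
    sumTo j (rhs-term m B)               ≡⟨ cong (λ t → sumTo t (rhs-term m B)) (suc-double/2 j) ⟨
    sumTo (m ℕD./ 2) (rhs-term m B)      ∎)
    where m = suc (j ℕ.+ j)

S : ℕ → ℚ → ℚ
S n B = sumTo (n ℕD./ 2) (summand (nℚ n) B)

closed-form : ℕ → ℚ → ℚ
closed-form n B = ½ * (poch (nℚ (2 ℕ.* n) + nℚ 2 * B) n * inv (poch (1ℚ + B) n))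

S-recurrence : ∀ n B → 1 ≤ n → (∀ i → i ≤ n → 1ℚ + B + nℚ i ≢ 0ℚ) →
  (1ℚ + B) * S (suc n) B ≡ coeff (nℚ n) B * S n (B + 1ℚ)
S-recurrence n B 1≤n hyp = begin
  (1ℚ + B) * S (suc n) B                                  ≡⟨ sumTo-*-distribˡ (1ℚ + B) (summand (nℚ (suc n)) B) (suc n ℕD./ 2) ⟨
  sumTo (suc n ℕD./ 2) (lhs-term n B)                     ≡⟨ sums-agree n B 1≤n hyp ⟩
  sumTo (n ℕD./ 2) (rhs-term n B)                         ≡⟨ sumTo-*-distribˡ (coeff (nℚ n) B) (summand (nℚ n) (B + 1ℚ)) (n ℕD./ 2) ⟩
  coeff (nℚ n) B * S n (B + 1ℚ)                           ∎
  where open ≡-Reasoning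

closed-form-recurrence : ∀ n B → 1ℚ + B ≢ 0ℚ →
  (1ℚ + B) * closed-form (suc n) B ≡ coeff (nℚ n) B * closed-form n (B + 1ℚ)
closed-form-recurrence n B 1+B≢0 = begin
  (1ℚ + B) * (½ * (poch A (suc n) * inv (poch (1ℚ + B) (suc n))))
    ≡⟨ cong₂ (λ a d → (1ℚ + B) * (½ * ((poch a n * (a + x)) * inv d))) A≡A′ (poch-suc-shift (1ℚ + B) n) ⟩
  (1ℚ + B) * (½ * ((Q * (A′ + x)) * inv ((1ℚ + B) * poch (1ℚ + B + 1ℚ) n)))
    ≡⟨ cong₂ (λ c d → (1ℚ + B) * (½ * ((Q * c) * inv ((1ℚ + B) * poch d n)))) last-factor (ℚP.+-assoc 1ℚ B 1ℚ) ⟩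
  (1ℚ + B) * (½ * ((Q * coeff x B) * inv ((1ℚ + B) * R)))
    ≡⟨ cong (λ t → (1ℚ + B) * (½ * ((Q * coeff x B) * t))) (inv-* (1ℚ + B) R) ⟩
  (1ℚ + B) * (½ * ((Q * coeff x B) * (inv (1ℚ + B) * inv R)))
    ≡⟨ regroup (1ℚ + B) (coeff x B) Q (inv (1ℚ + B)) (inv R) ⟩
  ((1ℚ + B) * inv (1ℚ + B)) * (coeff x B * (½ * (Q * inv R)))
    ≡⟨ cong (_* (coeff x B * (½ * (Q * inv R)))) (*-invʳ (1ℚ + B) 1+B≢0) ⟩
  1ℚ * (coeff x B * closed-form n (B + 1ℚ))
    ≡⟨ ℚP.*-identityˡ _ ⟩
  coeff x B * closed-form n (B + 1ℚ)
    ∎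
  where
  open ≡-Reasoning
  x = nℚ n
  A = nℚ (2 ℕ.* suc n) + nℚ 2 * B
  A′ = nℚ (2 ℕ.* n) + nℚ 2 * (B + 1ℚ)
  Q = poch A′ n
  R = poch (1ℚ + (B + 1ℚ)) n
  nℚ-double : ∀ m → nℚ (2 ℕ.* m) ≡ nℚ 2 * nℚ m
  nℚ-double = nℚ-* 2
  A≡A′ : A ≡ A′
  A≡A′ = begin
    nℚ (2 ℕ.* suc n) + nℚ 2 * B       ≡⟨ cong (λ t → t + nℚ 2 * B) (trans (nℚ-double (suc n)) (cong (nℚ 2 *_) (nℚ-suc n))) ⟩
    nℚ 2 * (x + 1ℚ) + nℚ 2 * B        ≡⟨ shift x B ⟩
    nℚ 2 * x + nℚ 2 * (B + 1ℚ)        ≡⟨ cong (λ t → t + nℚ 2 * (B + 1ℚ)) (nℚ-double n) ⟨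
    A′                                ∎
    where
    shift : ∀ x B → nℚ 2 * (x + 1ℚ) + nℚ 2 * B ≡ nℚ 2 * x + nℚ 2 * (B + 1ℚ)
    shift = solve-∀ ℚ-ring
  last-factor : A′ + x ≡ coeff x B
  last-factor = trans (cong (λ t → t + nℚ 2 * (B + 1ℚ) + x) (nℚ-double n)) (collect x B)
    where
    collect : ∀ x B → nℚ 2 * x + nℚ 2 * (B + 1ℚ) + x ≡ nℚ 3 * x + nℚ 2 * B + nℚ 2
    collect = solve-∀ ℚ-ring
  regroup : ∀ b c q ib iR → b * (½ * ((q * c) * (ib * iR))) ≡ (b * ib) * (c * (½ * (q * iR)))
  regroup = solve-∀ ℚ-ring

S≡closed-form : ∀ n → 1 ≤ n → ∀ B → (∀ i → i < n → 1ℚ + B + nℚ i ≢ 0ℚ) → S n B ≡ closed-form n B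
S≡closed-form (suc zero) _ B hyp = sym (begin
  ½ * ((1ℚ * (nℚ 2 + nℚ 2 * B + 0ℚ)) * inv d)   ≡⟨ cong (λ t → ½ * (t * inv d)) (twice B) ⟩
  ½ * ((nℚ 2 * d) * inv d)                       ≡⟨ cong (½ *_) (*-inv-cancelʳ (nℚ 2) d≢0) ⟩
  1ℚ                                             ∎)
  where
  open ≡-Reasoning
  d = 1ℚ * (1ℚ + B + 0ℚ)
  d≢0 : d ≢ 0ℚ
  d≢0 = subst (_≢ 0ℚ) (unit B) (hyp 0 (s≤s z≤n))
    where
    unit : ∀ B → 1ℚ + B + 0ℚ ≡ 1ℚ * (1ℚ + B + 0ℚ)
    unit = solve-∀ ℚ-ring
  twice : ∀ B → 1ℚ * (nℚ 2 + nℚ 2 * B + 0ℚ) ≡ nℚ 2 * (1ℚ * (1ℚ + B + 0ℚ))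
  twice = solve-∀ ℚ-ring
S≡closed-form (suc (suc m)) _ B hyp = *-cancelˡ-≡ (1ℚ + B) 1+B≢0 (begin
  (1ℚ + B) * S (suc (suc m)) B                          ≡⟨ S-recurrence (suc m) B (s≤s z≤n) (λ i i≤n → hyp i (s≤s i≤n)) ⟩
  coeff (nℚ (suc m)) B * S (suc m) (B + 1ℚ)             ≡⟨ cong (coeff (nℚ (suc m)) B *_) (S≡closed-form (suc m) (s≤s z≤n) (B + 1ℚ) hyp′) ⟩
  coeff (nℚ (suc m)) B * closed-form (suc m) (B + 1ℚ)   ≡⟨ closed-form-recurrence (suc m) B 1+B≢0 ⟨
  (1ℚ + B) * closed-form (suc (suc m)) B                ∎)
  where
  open ≡-Reasoning
  1+B≢0 : 1ℚ + B ≢ 0ℚ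
  1+B≢0 = subst (_≢ 0ℚ) (ℚP.+-identityʳ (1ℚ + B)) (hyp 0 (s≤s z≤n))
  hyp′ : ∀ i → i < suc m → 1ℚ + (B + 1ℚ) + nℚ i ≢ 0ℚ
  hyp′ i i<1+m = subst (_≢ 0ℚ) (trans (cong (λ t → 1ℚ + B + t) (nℚ-suc i)) (shift B (nℚ i))) (hyp (suc i) (s≤s i<1+m))
    where
    shift : ∀ B I → 1ℚ + B + (I + 1ℚ) ≡ 1ℚ + (B + 1ℚ) + I
    shift = solve-∀ ℚ-ring

n/2≡n*½ : ∀ n → + n / 2 ≡ nℚ n * ½
n/2≡n*½ n = i/n≡i*[1/n] n 1

2n/3≡2*n*⅓ : ∀ n → + (2 ℕ.* n) / 3 ≡ nℚ 2 * nℚ n * ⅓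
2n/3≡2*n*⅓ n = trans (i/n≡i*[1/n] (2 ℕ.* n) 2) (cong (_* ⅓) (nℚ-* 2 n))

F54≡S : ∀ n B →
  F54 (n ℕD./ 2)
    (1ℚ - (+ (2 ℕ.* n)) / 3) (- (+ n / 2)) (½ - (+ n / 2)) (- nℚ (2 ℕ.* n) - B) (nℚ (2 ℕ.* n) + nℚ 2 * B)
    (- ((+ (2 ℕ.* n)) / 3)) (1ℚ - nℚ n) (½ + B * ½) (1ℚ + B * ½)
  ≡ S n B
F54≡S n B = trans
  (cong₂ (λ p q → F54 (n ℕD./ 2) (1ℚ - p) (- q) (½ - q) (- nℚ (2 ℕ.* n) - B) (nℚ (2 ℕ.* n) + nℚ 2 * B)
                      (- p) (1ℚ - nℚ n) (½ + B * ½) (1ℚ + B * ½))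
         (2n/3≡2*n*⅓ n) (n/2≡n*½ n))
  (cong (λ r → F54 (n ℕD./ 2) (1ℚ - nℚ 2 * nℚ n * ⅓) (- (nℚ n * ½)) (½ - nℚ n * ½) (- r - B) (r + nℚ 2 * B)
                   (- (nℚ 2 * nℚ n * ⅓)) (1ℚ - nℚ n) (½ + B * ½) (1ℚ + B * ½))
        (nℚ-* 2 n))

corollaryA5 : (n : ℕ) → 1 ≤ n → (B : ℚ)
  → (∀ k → k ≤ n ℕD./ 2 → (poch (½ + B * ½) k ≢ 0ℚ) × (poch (1ℚ + B * ½) k ≢ 0ℚ))
  → poch (1ℚ + B) n ≢ 0ℚ
  → F54 (n ℕD./ 2)
      (1ℚ - (+ (2 ℕ.* n)) / 3) (- (+ n / 2)) (½ - (+ n / 2)) (- nℚ (2 ℕ.* n) - B) (nℚ (2 ℕ.* n) + nℚ 2 * B)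
      (- ((+ (2 ℕ.* n)) / 3)) (1ℚ - nℚ n) (½ + B * ½) (1ℚ + B * ½)
    ≡ ½ * (poch (nℚ (2 ℕ.* n) + nℚ 2 * B) n * inv (poch (1ℚ + B) n))
corollaryA5 n 1≤n B _ [1+B]ₙ≢0 =
  trans (F54≡S n B) (S≡closed-form n 1≤n B (poch≢0⁻¹ (1ℚ + B) n [1+B]ₙ≢0))
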